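{- All shortened-$1$-perfect-like codes are completely regular and uniformly packed.
   Context: $H(n,q)$ is the Hamming graph on the $n$-words over $\{0,1,\ldots,q-1\}$, adjacent words differing in exactly one position, with Hamming distance $d(\cdot,\cdot)$. An $(n,M,d)_q$-code is a set of $M$ vertices of $H(n,q)$ with minimum distance $d$. Shortened-$1$-perfect-like codes are codes with the parameters of $q$-ary shortened $1$-perfect (Hamming) codes, i.e., $(n=(q^m-q)/(q-1),\,q^{n-m},\,3)_q$ codes (here $q>2$, so that $n\equiv q \bmod q^2$). For a code $C$, $C^{(i)}$ denotes the set of vertices at distance $i$ from $C$; $C$ is completely regular if for any $i,j$ the number of neighbors in $C^{(j)}$ is the same for all words of $C^{(i)}$. Uniformly packed is in the sense of Goethals and van Tilborg. -}

module Defs where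

open import Data.Nat using (ℕ; zero; suc; _∸_; _^_; _≤_; _<_; _⊓_; _≟_)
open import Data.Fin using (Fin)
import Data.Fin as F
open import Data.Vec using (Vec; []; _∷_)
open import Data.List using (List; []; _∷_; [_]; map; concatMap; foldr; length; filter; allFin)
open import Data.List.Membership.Propositional using (_∈_)
open import Data.List.Relation.Unary.Unique.Propositional using (Unique)
open import Data.Product using (_×_; Σ; ∃; _,_)
open import Relation.Nullary using (¬_; yes; no)
open import Relation.Nullary.Decidable using (_×-dec_)
open import Relation.Binary.PropositionalEquality using (_≡_)
open import Data.Integer using (+_)
open import Data.Rational using (ℚ; _/_; _+_; _*_; 1ℚ)

Word : ℕ → ℕ → Set
Word q n = Vec (Fin q) n

dist : ∀ {q n} → Word q n → Word q n → ℕ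
dist [] [] = 0
dist (a ∷ x) (b ∷ y) with a F.≟ b
... | yes _ = dist x y
... | no  _ = suc (dist x y)

allWords : (q n : ℕ) → List (Word q n)
allWords q zero = [ [] ]
allWords q (suc n) = concatMap (λ a → map (a ∷_) (allWords q n)) (allFin q)

-- A code is a duplicate-free list of words (a set of vertices).
Code : ℕ → ℕ → Set
Code q n = List (Word q n)

-- Distance from a word to a code: the minimum of d(x,c) over c ∈ C
-- (starting the fold at n, which is ≥ every distance; correct for nonempty C).
distC : ∀ {q n} → Code q n → Word q n → ℕ
distC {n = n} C x = foldr (λ c r → dist x c ⊓ r) n C

IsCode : ∀ {q n} → Code q n → (M d : ℕ) → Set
IsCode {q} {n} C M d =
  Unique C × length C ≡ M
  × (∀ {c c'} → c ∈ C → c' ∈ C → ¬ (c ≡ c') → d ≤ dist c c')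
  × Σ (Word q n) (λ c → Σ (Word q n) (λ c' → c ∈ C × c' ∈ C × dist c c' ≡ d))

nbrsIn : ∀ {q n} → Code q n → ℕ → Word q n → ℕ
nbrsIn {q} {n} C j x =
  length (filter (λ y → (dist x y ≟ 1) ×-dec (distC C y ≟ j)) (allWords q n))

CompletelyRegular : ∀ {q n} → Code q n → Set
CompletelyRegular {q} {n} C =
  ∀ (i j : ℕ) (x y : Word q n) → distC C x ≡ i → distC C y ≡ i →
  nbrsIn C j x ≡ nbrsIn C j y

A : ∀ {q n} → Code q n → ℕ → Word q n → ℕ
A C i x = length (filter (λ c → dist x c ≟ i) C)

toℚ : ℕ → ℚ
toℚ k = + k / 1

-- Uniformly packed in the sense of Goethals and van Tilborg, for a code
-- correcting e errors: there are rationals α_0,…,α_{e+1} with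
-- Σ_{i=0}^{e+1} α_i A_i(x) = 1 for every vertex x.
-- Here d = 3, so e = 1 and we need α_0, α_1, α_2.
UniformlyPacked₁ : ∀ {q n} → Code q n → Set
UniformlyPacked₁ {q} {n} C =
  Σ ℚ λ α₀ → Σ ℚ λ α₁ → Σ ℚ λ α₂ → ∀ (x : Word q n) →
    α₀ * toℚ (A C 0 x) + α₁ * toℚ (A C 1 x) + α₂ * toℚ (A C 2 x) ≡ 1ℚ

{-# OPTIONS --safe #-}
module Submission where

-- Write χ for the indicator of C, A for the adjacency operator of H(n,q) and K = n(q - 1) for its
-- valency, so that A has the eigenvalues K - qi.  As q divides K, every eigenvalue λ of A satisfies
-- λ(λ + q) ≥ 0: the quadratic form ⟨Au, (A + q)u⟩ is nonnegative and vanishes only if A(A + q)u = 0.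
-- Both facts are proved without spectral theory, by induction on n: splitting a function on H(n+1,q)
-- into its sum and its zero-sum deviations along the first letter decomposes the form orthogonally
-- into two forms of the same kind on H(n,q).
--   Minimum distance 3 gives Aχ(Aχ + qχ - 1) = 0 pointwise; together with |C|(K + q) = qⁿ this makes
-- the form vanish at u = (K + q)χ - 1, so (A² + qA)χ = K.  At a word x this reads
-- K A₀(x) + 2(q - 1) A₁(x) + 2 A₂(x) = K, which is uniform packing.  It also shows that every word is
-- within distance 2 of C, that the indicators of C⁽⁰⁾, C⁽¹⁾, C⁽²⁾ are χ, Aχ, 1 - χ - Aχ, and that A maps
-- each of them to a function of Aχ; this is complete regularity.

open import Data.Nat as ℕ using (ℕ; zero; suc; _∸_)
import Data.Nat.Properties as ℕₚ
open import Data.Fin as Fin using (Fin; zero; suc)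
import Data.Fin.Properties as Finₚ
open import Data.Integer as ℤ using (ℤ; +_)
open import Data.Vec using ([]; _∷_)
open import Data.List using (List; []; _∷_; _++_; map; concatMap; filter; length; lookup; allFin; tabulate)
open import Data.List.Membership.Propositional using (_∈_)
open import Data.List.Relation.Unary.Any using (here; there)
open import Data.List.Relation.Unary.Unique.Propositional using (Unique)
open import Data.Bool using (true; false; if_then_else_)
open import Data.Product using (_×_; _,_; proj₁; proj₂)
open import Data.Sum using (inj₁; inj₂; [_,_]′)
open import Function using (_∘_; id)
open import Relation.Nullary using (Dec; does; yes; no; ¬_; contradiction)
open import Relation.Nullary.Decidable using (_×-dec_)
open import Relation.Binary.PropositionalEquality

open import Defs

module Integers where
  open ≡-Reasoning
  open import Data.Integer hiding (suc; _≟_)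
  open import Data.Integer.Properties hiding (_≟_)
  open import Data.Integer.Tactic.RingSolver using (solve-∀)
  open import Algebra.Properties.Semiring.Sum +-*-semiring public
    using (sum; sum-syntax; sum-cong-≗; sum-replicate-zero; ∑-distrib-+; ∑-comm; *-distribˡ-sum)

  𝟙 : {P : Set} → Dec P → ℤ
  𝟙 P? = if does P? then 1ℤ else 0ℤ

  𝟙-×-dec : {P Q : Set} (P? : Dec P) (Q? : Dec Q) → 𝟙 (P? ×-dec Q?) ≡ 𝟙 P? * 𝟙 Q?
  𝟙-×-dec (yes _) Q? = sym (*-identityˡ (𝟙 Q?))
  𝟙-×-dec (no _)  Q? = refl

  ∑-cong : ∀ {k} {f g : Fin k → ℤ} → (∀ i → f i ≡ g i) → ∑[ i < k ] f i ≡ ∑[ i < k ] g i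
  ∑-cong = sum-cong-≗

  ∑-const : ∀ k c → ∑[ i < k ] c ≡ + k * c
  ∑-const zero    c = refl
  ∑-const (suc k) c = begin
    c + ∑[ i < k ] c  ≡⟨ cong (_+_ c) (∑-const k c) ⟩
    c + + k * c       ≡⟨ distrib c (+ k) ⟩
    (1ℤ + + k) * c    ∎
    where distrib : ∀ c k → c + k * c ≡ (1ℤ + k) * c
          distrib = solve-∀

  ∑-update : ∀ {k} (j : Fin k) (f g : Fin k → ℤ) → (∀ i → i ≢ j → f i ≡ g i) →
             ∑[ i < k ] f i ≡ ∑[ i < k ] g i + (f j - g j)
  ∑-update zero f g agree = begin
    f zero + sum (f ∘ suc)                      ≡⟨ cong (_+_ (f zero)) (∑-cong (λ i → agree (suc i) λ ())) ⟩
    f zero + sum (g ∘ suc)                      ≡⟨ regroup (f zero) (g zero) (sum (g ∘ suc)) ⟩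
    g zero + sum (g ∘ suc) + (f zero - g zero)  ∎
    where regroup : ∀ a b s → a + s ≡ b + s + (a - b)
          regroup = solve-∀
  ∑-update (suc j) f g agree = begin
    f zero + sum (f ∘ suc)
      ≡⟨ cong₂ _+_ (agree zero λ ()) (∑-update j (f ∘ suc) (g ∘ suc) agree′) ⟩
    g zero + (sum (g ∘ suc) + (f (suc j) - g (suc j)))
      ≡⟨ +-assoc (g zero) _ _ ⟨
    g zero + sum (g ∘ suc) + (f (suc j) - g (suc j))
      ∎
    where agree′ : ∀ i → i ≢ j → f (suc i) ≡ g (suc i)
          agree′ i i≢j = agree (suc i) (i≢j ∘ Finₚ.suc-injective)

  ∑-single : ∀ {k} (j : Fin k) (f : Fin k → ℤ) → (∀ i → i ≢ j → f i ≡ 0ℤ) →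
             ∑[ i < k ] f i ≡ f j
  ∑-single {k} j f vanish = begin
    ∑[ i < k ] f i              ≡⟨ ∑-update j f (λ _ → 0ℤ) vanish ⟩
    ∑[ i < k ] 0ℤ + (f j - 0ℤ)  ≡⟨ cong₂ _+_ (sum-replicate-zero k) (+-identityʳ (f j)) ⟩
    0ℤ + f j                    ≡⟨ +-identityˡ (f j) ⟩
    f j                         ∎

  +-nonneg-≡0 : ∀ {i j} → 0ℤ ≤ i → 0ℤ ≤ j → i + j ≡ 0ℤ → i ≡ 0ℤ × j ≡ 0ℤ
  +-nonneg-≡0 {i} {j} 0≤i 0≤j i+j≡0 = i≡0 , j≡0
    where
    i≡0 : i ≡ 0ℤ
    i≡0 = ≤-antisym (subst (i ≤_) i+j≡0 (i≤i+j i j {{nonNegative 0≤j}})) 0≤i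
    j≡0 : j ≡ 0ℤ
    j≡0 = trans (sym (+-identityˡ j)) (trans (cong (_+ j) (sym i≡0)) i+j≡0)

  ∑-nonneg : ∀ {k} (f : Fin k → ℤ) → (∀ i → 0ℤ ≤ f i) → 0ℤ ≤ ∑[ i < k ] f i
  ∑-nonneg {zero}  f 0≤f = ≤-refl
  ∑-nonneg {suc k} f 0≤f = +-mono-≤ (0≤f zero) (∑-nonneg (f ∘ suc) (0≤f ∘ suc))

  ∑-nonneg-≡0 : ∀ {k} (f : Fin k → ℤ) → (∀ i → 0ℤ ≤ f i) → ∑[ i < k ] f i ≡ 0ℤ →
                ∀ i → f i ≡ 0ℤ
  ∑-nonneg-≡0 {zero}  f 0≤f ∑≡0 ()
  ∑-nonneg-≡0 {suc k} f 0≤f ∑≡0 = pointwise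
    where
    head∧tail≡0 : f zero ≡ 0ℤ × sum (f ∘ suc) ≡ 0ℤ
    head∧tail≡0 = +-nonneg-≡0 (0≤f zero) (∑-nonneg (f ∘ suc) (0≤f ∘ suc)) ∑≡0
    pointwise : ∀ i → f i ≡ 0ℤ
    pointwise zero    = proj₁ head∧tail≡0
    pointwise (suc i) = ∑-nonneg-≡0 (f ∘ suc) (0≤f ∘ suc) (proj₂ head∧tail≡0) i

  *-nonneg : ∀ {i j} → 0ℤ ≤ i → 0ℤ ≤ j → 0ℤ ≤ i * j
  *-nonneg {i} 0≤i 0≤j = subst (_≤ i * _) (*-zeroʳ i) (*-monoˡ-≤-nonNeg i {{nonNegative 0≤i}} 0≤j)

  square-nonneg : ∀ i → 0ℤ ≤ i * i
  square-nonneg (+ n)    = subst (0ℤ ≤_) (pos-* n n) (+≤+ ℕ.z≤n)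
  square-nonneg -[1+ n ] = +≤+ ℕ.z≤n

  consecutive-nonneg : ∀ i → 0ℤ ≤ (i - 1ℤ) * i
  consecutive-nonneg +0       = +≤+ ℕ.z≤n
  consecutive-nonneg +[1+ n ] = subst (0ℤ ≤_) (pos-* n (suc n)) (+≤+ ℕ.z≤n)
  consecutive-nonneg -[1+ n ] = +≤+ ℕ.z≤n

  ∑ˡ : {A : Set} → List A → (A → ℤ) → ℤ
  ∑ˡ xs f = ∑[ i < length xs ] f (lookup xs i)

  ∑ˡ-count : {A : Set} {P : A → Set} (P? : ∀ x → Dec (P x)) (xs : List A) →
             + length (filter P? xs) ≡ ∑ˡ xs (𝟙 ∘ P?)
  ∑ˡ-count P? []       = refl
  ∑ˡ-count P? (x ∷ xs) with does (P? x)
  ... | true  = trans (pos-+ 1 (length (filter P? xs))) (cong (_+_ 1ℤ) (∑ˡ-count P? xs))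
  ... | false = trans (∑ˡ-count P? xs) (sym (+-identityˡ _))

  ∑ˡ-++ : {A : Set} (xs ys : List A) (f : A → ℤ) → ∑ˡ (xs ++ ys) f ≡ ∑ˡ xs f + ∑ˡ ys f
  ∑ˡ-++ []       ys f = sym (+-identityˡ _)
  ∑ˡ-++ (x ∷ xs) ys f = trans (cong (_+_ (f x)) (∑ˡ-++ xs ys f)) (sym (+-assoc (f x) _ _))

  ∑ˡ-map : {A B : Set} (g : A → B) (xs : List A) (f : B → ℤ) → ∑ˡ (map g xs) f ≡ ∑ˡ xs (f ∘ g)
  ∑ˡ-map g []       f = refl
  ∑ˡ-map g (x ∷ xs) f = cong (_+_ (f (g x))) (∑ˡ-map g xs f)

  ∑ˡ-concatMap : {A B : Set} (g : A → List B) (xs : List A) (f : B → ℤ) →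
                 ∑ˡ (concatMap g xs) f ≡ ∑ˡ xs (λ x → ∑ˡ (g x) f)
  ∑ˡ-concatMap g []       f = refl
  ∑ˡ-concatMap g (x ∷ xs) f =
    trans (∑ˡ-++ (g x) (concatMap g xs) f) (cong (_+_ (∑ˡ (g x) f)) (∑ˡ-concatMap g xs f))

  ∑ˡ-tabulate : {A : Set} {k : ℕ} (g : Fin k → A) (f : A → ℤ) →
                ∑ˡ (tabulate g) f ≡ ∑[ i < k ] f (g i)
  ∑ˡ-tabulate {k = zero}  g f = refl
  ∑ˡ-tabulate {k = suc k} g f = cong (_+_ (f (g zero))) (∑ˡ-tabulate (g ∘ suc) f)

module HammingGraph (q : ℕ) where
  open ≡-Reasoning
  open import Data.Integer hiding (suc; _≟_)
  open import Data.Integer.Properties hiding (_≟_)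
  open import Data.Integer.Tactic.RingSolver using (solve-∀)
  open import Data.Nat using (_≟_)
  open Integers

  private variable
    n : ℕ

  dist-∷-≡ : (a : Fin q) (x y : Word q n) → dist (a ∷ x) (a ∷ y) ≡ dist x y
  dist-∷-≡ a x y with a Fin.≟ a
  ... | yes _  = refl
  ... | no a≢a = contradiction refl a≢a

  dist-∷-≢ : {a b : Fin q} → a ≢ b → (x y : Word q n) → dist (a ∷ x) (b ∷ y) ≡ suc (dist x y)
  dist-∷-≢ {a = a} {b} a≢b x y with a Fin.≟ b
  ... | yes a≡b = contradiction a≡b a≢b
  ... | no _    = refl

  dist-∷-≤ : (a b : Fin q) (x y : Word q n) → dist (a ∷ x) (b ∷ y) ℕ.≤ suc (dist x y)
  dist-∷-≤ a b x y with a Fin.≟ b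
  ... | yes _ = ℕₚ.n≤1+n (dist x y)
  ... | no _  = ℕₚ.≤-refl

  dist-sym : (x y : Word q n) → dist x y ≡ dist y x
  dist-sym []      []      = refl
  dist-sym (a ∷ x) (b ∷ y) = by-cases (a Fin.≟ b)
    where
    by-cases : Dec (a ≡ b) → dist (a ∷ x) (b ∷ y) ≡ dist (b ∷ y) (a ∷ x)
    by-cases (yes refl) = trans (dist-∷-≡ a x y) (trans (dist-sym x y) (sym (dist-∷-≡ a y x)))
    by-cases (no a≢b)   =
      trans (dist-∷-≢ a≢b x y) (trans (cong suc (dist-sym x y)) (sym (dist-∷-≢ (a≢b ∘ sym) y x)))

  dist≡0⇒≡ : (x y : Word q n) → dist x y ≡ 0 → x ≡ y
  dist≡0⇒≡ []      []      _   = refl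
  dist≡0⇒≡ (a ∷ x) (b ∷ y) d≡0 = by-cases (a Fin.≟ b)
    where
    by-cases : Dec (a ≡ b) → a ∷ x ≡ b ∷ y
    by-cases (yes refl) = cong (a ∷_) (dist≡0⇒≡ x y (trans (sym (dist-∷-≡ a x y)) d≡0))
    by-cases (no a≢b)   = contradiction (trans (sym (dist-∷-≢ a≢b x y)) d≡0) λ ()

  dist-triangle : (x y z : Word q n) → dist x z ℕ.≤ dist x y ℕ.+ dist y z
  dist-triangle []      []      []      = ℕ.z≤n
  dist-triangle (a ∷ x) (b ∷ y) (c ∷ z) = by-cases (a Fin.≟ b) (b Fin.≟ c)
    where
    ih : dist x z ℕ.≤ dist x y ℕ.+ dist y z
    ih = dist-triangle x y z
    by-cases : Dec (a ≡ b) → Dec (b ≡ c) →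
               dist (a ∷ x) (c ∷ z) ℕ.≤ dist (a ∷ x) (b ∷ y) ℕ.+ dist (b ∷ y) (c ∷ z)
    by-cases (yes refl) (yes refl)
      rewrite dist-∷-≡ a x z | dist-∷-≡ a x y | dist-∷-≡ a y z = ih
    by-cases (yes refl) (no b≢c)
      rewrite dist-∷-≢ b≢c x z | dist-∷-≡ a x y | dist-∷-≢ b≢c y z =
      ℕₚ.≤-trans (ℕ.s≤s ih) (ℕₚ.≤-reflexive (sym (ℕₚ.+-suc (dist x y) (dist y z))))
    by-cases (no a≢b) (yes refl)
      rewrite dist-∷-≢ a≢b x z | dist-∷-≢ a≢b x y | dist-∷-≡ b y z = ℕ.s≤s ih
    by-cases (no a≢b) (no b≢c)
      rewrite dist-∷-≢ a≢b x y | dist-∷-≢ b≢c y z =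
      ℕₚ.≤-trans (dist-∷-≤ a c x z)
                 (ℕ.s≤s (ℕₚ.≤-trans ih (ℕₚ.+-monoʳ-≤ (dist x y) (ℕₚ.n≤1+n (dist y z)))))

  -- distC starts its fold at n, whence the side condition k ≤ n.
  distC-≡ : (C : Code q n) {y c : Word q n} {k : ℕ} → c ∈ C → dist y c ≡ k →
            (∀ {c′} → c′ ∈ C → k ℕ.≤ dist y c′) → k ℕ.≤ n → distC C y ≡ k
  distC-≡ {n} C {y} {c} {k} c∈C d≡k k≤d k≤n = ℕₚ.≤-antisym (upper C c∈C) (lower C k≤d)
    where
    upper : ∀ xs → c ∈ xs → distC xs y ℕ.≤ k
    upper (_ ∷ xs)  (here refl) = ℕₚ.≤-trans (ℕₚ.m⊓n≤m (dist y c) _) (ℕₚ.≤-reflexive d≡k)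
    upper (c′ ∷ xs) (there c∈)  = ℕₚ.≤-trans (ℕₚ.m⊓n≤n (dist y c′) _) (upper xs c∈)
    lower : ∀ xs → (∀ {c′} → c′ ∈ xs → k ℕ.≤ dist y c′) → k ℕ.≤ distC xs y
    lower []        _   = k≤n
    lower (c′ ∷ xs) k≤d = ℕₚ.⊓-glb (k≤d (here refl)) (lower xs (k≤d ∘ there))

  sphere : ℕ → Word q n → Word q n → ℤ
  sphere r c y = 𝟙 (dist c y ≟ r)

  sphere-sym : ∀ r (x y : Word q n) → sphere r x y ≡ sphere r y x
  sphere-sym r x y = cong (λ d → 𝟙 (d ≟ r)) (dist-sym x y)

  sphere-∷-≡ : ∀ r a (c y : Word q n) → sphere r (a ∷ c) (a ∷ y) ≡ sphere r c y
  sphere-∷-≡ r a c y = cong (λ d → 𝟙 (d ≟ r)) (dist-∷-≡ a c y)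

  sphere-∷-≢ : ∀ r {a b} → a ≢ b → (c y : Word q n) →
               sphere (suc r) (a ∷ c) (b ∷ y) ≡ sphere r c y
  sphere-∷-≢ r a≢b c y = cong (λ d → 𝟙 (d ≟ suc r)) (dist-∷-≢ a≢b c y)

  sphere₀-∷-≢ : ∀ {a b} → a ≢ b → (c y : Word q n) → sphere 0 (a ∷ c) (b ∷ y) ≡ 0ℤ
  sphere₀-∷-≢ a≢b c y = cong (λ d → 𝟙 (d ≟ 0)) (dist-∷-≢ a≢b c y)

  ∑-sphere-∷ : ∀ r a (c x : Word q n) →
    ∑[ b < q ] sphere (suc r) (a ∷ c) (b ∷ x) ≡ + q * sphere r c x + (sphere (suc r) c x - sphere r c x)
  ∑-sphere-∷ r a c x = begin
    ∑[ b < q ] sphere (suc r) (a ∷ c) (b ∷ x)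
      ≡⟨ ∑-update a (λ b → sphere (suc r) (a ∷ c) (b ∷ x)) (λ _ → sphere r c x) off-a ⟩
    ∑[ b < q ] sphere r c x + (sphere (suc r) (a ∷ c) (a ∷ x) - sphere r c x)
      ≡⟨ cong₂ (λ s t → s + (t - sphere r c x)) (∑-const q (sphere r c x)) (sphere-∷-≡ (suc r) a c x) ⟩
    + q * sphere r c x + (sphere (suc r) c x - sphere r c x)
      ∎
    where
    off-a : ∀ b → b ≢ a → sphere (suc r) (a ∷ c) (b ∷ x) ≡ sphere r c x
    off-a b b≢a = sphere-∷-≢ r (b≢a ∘ sym) c x

  Σʷ : (Word q n → ℤ) → ℤ
  Σʷ {zero}  f = f []
  Σʷ {suc n} f = ∑[ b < q ] Σʷ (λ x → f (b ∷ x))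

  Σʷ-cong : {f g : Word q n → ℤ} → (∀ x → f x ≡ g x) → Σʷ f ≡ Σʷ g
  Σʷ-cong {zero}  f≗g = f≗g []
  Σʷ-cong {suc n} f≗g = ∑-cong (λ b → Σʷ-cong (λ x → f≗g (b ∷ x)))

  Σʷ-distrib-+ : (f g : Word q n → ℤ) → Σʷ (λ x → f x + g x) ≡ Σʷ f + Σʷ g
  Σʷ-distrib-+ {zero}  f g = refl
  Σʷ-distrib-+ {suc n} f g =
    trans (∑-cong (λ b → Σʷ-distrib-+ (λ x → f (b ∷ x)) (λ x → g (b ∷ x))))
          (∑-distrib-+ (λ b → Σʷ (λ x → f (b ∷ x))) (λ b → Σʷ (λ x → g (b ∷ x))))

  *-distribˡ-Σʷ : ∀ c (f : Word q n → ℤ) → c * Σʷ f ≡ Σʷ (λ x → c * f x)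
  *-distribˡ-Σʷ {zero}  c f = refl
  *-distribˡ-Σʷ {suc n} c f =
    trans (*-distribˡ-sum c (λ b → Σʷ (λ x → f (b ∷ x))))
          (∑-cong (λ b → *-distribˡ-Σʷ c (λ x → f (b ∷ x))))

  Σʷ-const : ∀ n c → Σʷ {n} (λ _ → c) ≡ + (q ℕ.^ n) * c
  Σʷ-const zero    c = sym (*-identityˡ c)
  Σʷ-const (suc n) c = begin
    ∑[ b < q ] Σʷ {n} (λ _ → c)   ≡⟨ ∑-cong {q} (λ _ → Σʷ-const n c) ⟩
    ∑[ b < q ] (+ (q ℕ.^ n) * c)  ≡⟨ ∑-const q (+ (q ℕ.^ n) * c) ⟩
    + q * (+ (q ℕ.^ n) * c)       ≡⟨ *-assoc (+ q) _ c ⟨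
    + q * + (q ℕ.^ n) * c         ≡⟨ cong (_* c) (pos-* q (q ℕ.^ n)) ⟨
    + (q ℕ.^ suc n) * c           ∎

  Σʷ-zero : ∀ n → Σʷ {n} (λ _ → 0ℤ) ≡ 0ℤ
  Σʷ-zero n = trans (Σʷ-const n 0ℤ) (*-zeroʳ (+ (q ℕ.^ n)))

  ∑-comm-Σʷ : ∀ {k} (h : Fin k → Word q n → ℤ) → ∑[ i < k ] Σʷ (h i) ≡ Σʷ (λ x → ∑[ i < k ] h i x)
  ∑-comm-Σʷ {zero}  h = refl
  ∑-comm-Σʷ {suc n} h =
    trans (∑-comm (λ i b → Σʷ (λ x → h i (b ∷ x))))
          (∑-cong (λ b → ∑-comm-Σʷ (λ i x → h i (b ∷ x))))

  Σʷ-sift : (x : Word q n) (h : Word q n → ℤ) → Σʷ (λ y → sphere 0 x y * h y) ≡ h x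
  Σʷ-sift []      h = *-identityˡ (h [])
  Σʷ-sift {suc n} (a ∷ x) h = begin
    ∑[ b < q ] Σʷ (λ y → sphere 0 (a ∷ x) (b ∷ y) * h (b ∷ y))
      ≡⟨ ∑-single a (λ b → Σʷ (λ y → sphere 0 (a ∷ x) (b ∷ y) * h (b ∷ y))) off-a ⟩
    Σʷ (λ y → sphere 0 (a ∷ x) (a ∷ y) * h (a ∷ y))
      ≡⟨ Σʷ-cong (λ y → cong (_* h (a ∷ y)) (sphere-∷-≡ 0 a x y)) ⟩
    Σʷ (λ y → sphere 0 x y * h (a ∷ y))
      ≡⟨ Σʷ-sift x (λ y → h (a ∷ y)) ⟩
    h (a ∷ x)
      ∎
    where
    off-a : ∀ b → b ≢ a → Σʷ (λ y → sphere 0 (a ∷ x) (b ∷ y) * h (b ∷ y)) ≡ 0ℤ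
    off-a b b≢a = trans (Σʷ-cong (λ y → trans (cong (_* h (b ∷ y)) (sphere₀-∷-≢ (b≢a ∘ sym) x y))
                                              (*-zeroˡ (h (b ∷ y)))))
                        (Σʷ-zero n)

  ∑ˡ-allWords : (f : Word q n → ℤ) → ∑ˡ (allWords q n) f ≡ Σʷ f
  ∑ˡ-allWords {zero}  f = +-identityʳ (f [])
  ∑ˡ-allWords {suc n} f = begin
    ∑ˡ (concatMap (λ a → map (a ∷_) (allWords q n)) (allFin q)) f
      ≡⟨ ∑ˡ-concatMap (λ a → map (a ∷_) (allWords q n)) (allFin q) f ⟩
    ∑ˡ (allFin q) (λ a → ∑ˡ (map (a ∷_) (allWords q n)) f)
      ≡⟨ ∑ˡ-tabulate id (λ a → ∑ˡ (map (a ∷_) (allWords q n)) f) ⟩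
    ∑[ a < q ] ∑ˡ (map (a ∷_) (allWords q n)) f
      ≡⟨ ∑-cong (λ a → trans (∑ˡ-map (a ∷_) (allWords q n) f) (∑ˡ-allWords (λ x → f (a ∷ x)))) ⟩
    ∑[ a < q ] Σʷ (λ x → f (a ∷ x))
      ∎

  ⟪_,_⟫ : (f g : Word q n → ℤ) → ℤ
  ⟪ f , g ⟫ = Σʷ (λ x → f x * g x)

  ∑-⟪⟫-orthogonal : ∀ {k} (f : Word q n → ℤ) (g : Fin k → Word q n → ℤ) →
                    (∀ x → ∑[ i < k ] g i x ≡ 0ℤ) → ∑[ i < k ] ⟪ f , g i ⟫ ≡ 0ℤ
  ∑-⟪⟫-orthogonal {n} {k} f g ∑g≡0 = begin
    ∑[ i < k ] ⟪ f , g i ⟫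
      ≡⟨ ∑-comm-Σʷ (λ i x → f x * g i x) ⟩
    Σʷ (λ x → ∑[ i < k ] (f x * g i x))
      ≡⟨ Σʷ-cong (λ x → sym (*-distribˡ-sum (f x) (λ i → g i x))) ⟩
    Σʷ (λ x → f x * ∑[ i < k ] g i x)
      ≡⟨ Σʷ-cong (λ x → trans (cong (f x *_) (∑g≡0 x)) (*-zeroʳ (f x))) ⟩
    Σʷ {n} (λ _ → 0ℤ)
      ≡⟨ Σʷ-zero n ⟩
    0ℤ
      ∎

  K : ℕ → ℤ
  K n = + n * (+ q - 1ℤ)

  -- The neighbours of b ∷ x are the words b ∷ y with y adjacent to x and the words b′ ∷ x with b′ ≢ b.
  adj : (Word q n → ℤ) → Word q n → ℤ
  adj {zero}  f []      = 0ℤ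
  adj {suc n} f (b ∷ x) = adj (λ y → f (b ∷ y)) x + (∑[ b′ < q ] f (b′ ∷ x) - f (b ∷ x))

  adj-cong : {f g : Word q n → ℤ} → (∀ y → f y ≡ g y) → ∀ x → adj f x ≡ adj g x
  adj-cong {zero}  f≗g []      = refl
  adj-cong {suc n} f≗g (b ∷ x) =
    cong₂ _+_ (adj-cong (λ y → f≗g (b ∷ y)) x)
              (cong₂ _-_ (∑-cong (λ b′ → f≗g (b′ ∷ x))) (f≗g (b ∷ x)))

  adj-+ : (f g : Word q n → ℤ) → ∀ x → adj (λ y → f y + g y) x ≡ adj f x + adj g x
  adj-+ {zero}  f g []      = refl
  adj-+ {suc n} f g (b ∷ x) = begin
    adj (λ y → fᵇ y + gᵇ y) x + (∑[ b′ < q ] (f (b′ ∷ x) + g (b′ ∷ x)) - (fᵇ x + gᵇ x))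
      ≡⟨ cong₂ (λ s t → s + (t - (fᵇ x + gᵇ x)))
               (adj-+ fᵇ gᵇ x) (∑-distrib-+ (λ b′ → f (b′ ∷ x)) (λ b′ → g (b′ ∷ x))) ⟩
    adj fᵇ x + adj gᵇ x + (∑[ b′ < q ] f (b′ ∷ x) + ∑[ b′ < q ] g (b′ ∷ x) - (fᵇ x + gᵇ x))
      ≡⟨ regroup (adj fᵇ x) (adj gᵇ x) (∑[ b′ < q ] f (b′ ∷ x)) (∑[ b′ < q ] g (b′ ∷ x))
                 (fᵇ x) (gᵇ x) ⟩
    adj f (b ∷ x) + adj g (b ∷ x)
      ∎
    where
    fᵇ gᵇ : Word q n → ℤ
    fᵇ y = f (b ∷ y)
    gᵇ y = g (b ∷ y)
    regroup : ∀ a c s t u v → a + c + (s + t - (u + v)) ≡ a + (s - u) + (c + (t - v))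
    regroup = solve-∀

  adj-* : ∀ c (f : Word q n → ℤ) x → adj (λ y → c * f y) x ≡ c * adj f x
  adj-* {zero}  c f []      = sym (*-zeroʳ c)
  adj-* {suc n} c f (b ∷ x) = begin
    adj (λ y → c * fᵇ y) x + (∑[ b′ < q ] (c * f (b′ ∷ x)) - c * fᵇ x)
      ≡⟨ cong₂ (λ s t → s + (t - c * fᵇ x))
               (adj-* c fᵇ x) (sym (*-distribˡ-sum c (λ b′ → f (b′ ∷ x)))) ⟩
    c * adj fᵇ x + (c * ∑[ b′ < q ] f (b′ ∷ x) - c * fᵇ x)
      ≡⟨ distrib c (adj fᵇ x) (∑[ b′ < q ] f (b′ ∷ x)) (fᵇ x) ⟩
    c * adj f (b ∷ x)
      ∎
    where
    fᵇ : Word q n → ℤ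
    fᵇ y = f (b ∷ y)
    distrib : ∀ c a s u → c * a + (c * s - c * u) ≡ c * (a + (s - u))
    distrib = solve-∀

  adj-- : (f g : Word q n → ℤ) → ∀ x → adj (λ y → f y - g y) x ≡ adj f x - adj g x
  adj-- f g x = begin
    adj (λ y → f y - g y) x            ≡⟨ adj-cong (λ y → cong (_+_ (f y)) (sym (-1*i≡-i (g y)))) x ⟩
    adj (λ y → f y + -1ℤ * g y) x      ≡⟨ adj-+ f (λ y → -1ℤ * g y) x ⟩
    adj f x + adj (λ y → -1ℤ * g y) x  ≡⟨ cong (_+_ (adj f x)) (trans (adj-* -1ℤ g x) (-1*i≡-i (adj g x))) ⟩
    adj f x - adj g x                  ∎

  adj-const : ∀ c (x : Word q n) → adj (λ _ → c) x ≡ K n * c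
  adj-const         c []      = sym (*-zeroˡ c)
  adj-const {suc n} c (b ∷ x) = begin
    adj (λ _ → c) x + (∑[ b′ < q ] c - c)  ≡⟨ cong₂ (λ s t → s + (t - c)) (adj-const c x) (∑-const q c) ⟩
    K n * c + (+ q * c - c)                ≡⟨ valency-step (+ n) (+ q) c ⟩
    K (suc n) * c                          ∎
    where valency-step : ∀ n q c → n * (q - 1ℤ) * c + (q * c - c) ≡ (1ℤ + n) * (q - 1ℤ) * c
          valency-step = solve-∀

  adj-zero : (x : Word q n) → adj (λ _ → 0ℤ) x ≡ 0ℤ
  adj-zero {n} x = trans (adj-const 0ℤ x) (*-zeroʳ (K n))

  adj-∑ : ∀ {k} (w : Fin k → Word q n → ℤ) x →
          adj (λ y → ∑[ i < k ] w i y) x ≡ ∑[ i < k ] adj (w i) x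
  adj-∑ {k = zero}  w x = adj-zero x
  adj-∑ {k = suc k} w x =
    trans (adj-+ (w zero) (λ y → ∑[ i < k ] w (suc i) y) x) (cong (_+_ (adj (w zero) x)) (adj-∑ (w ∘ suc) x))

  adj-neighbours : (f : Word q n → ℤ) (x : Word q n) → adj f x ≡ Σʷ (λ y → sphere 1 x y * f y)
  adj-neighbours f []      = sym (*-zeroˡ (f []))
  adj-neighbours f (a ∷ x) = begin
    adj fᵃ x + (∑[ b < q ] f (b ∷ x) - fᵃ x)
      ≡⟨ regroup (adj fᵃ x) (∑[ b < q ] f (b ∷ x)) (fᵃ x) ⟩
    ∑[ b < q ] f (b ∷ x) + (adj fᵃ x - fᵃ x)
      ≡⟨ cong (λ t → ∑[ b < q ] f (b ∷ x) + (t - fᵃ x)) (adj-neighbours fᵃ x) ⟩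
    ∑[ b < q ] f (b ∷ x) + (Σʷ (λ y → sphere 1 x y * fᵃ y) - fᵃ x)
      ≡⟨ cong (λ t → ∑[ b < q ] f (b ∷ x) + (t - fᵃ x))
              (Σʷ-cong (λ y → cong (_* fᵃ y) (sym (sphere-∷-≡ 1 a x y)))) ⟩
    ∑[ b < q ] f (b ∷ x) + (Σʷ (λ y → sphere 1 (a ∷ x) (a ∷ y) * fᵃ y) - fᵃ x)
      ≡⟨ ∑-update a (λ b → Σʷ (λ y → sphere 1 (a ∷ x) (b ∷ y) * f (b ∷ y)))
                    (λ b → f (b ∷ x)) off-a ⟨
    ∑[ b < q ] Σʷ (λ y → sphere 1 (a ∷ x) (b ∷ y) * f (b ∷ y))
      ∎
    where
    fᵃ : Word q _ → ℤ
    fᵃ y = f (a ∷ y)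
    regroup : ∀ a s u → a + (s - u) ≡ s + (a - u)
    regroup = solve-∀
    off-a : ∀ b → b ≢ a → Σʷ (λ y → sphere 1 (a ∷ x) (b ∷ y) * f (b ∷ y)) ≡ f (b ∷ x)
    off-a b b≢a = trans (Σʷ-cong (λ y → cong (_* f (b ∷ y)) (sphere-∷-≢ 0 (b≢a ∘ sym) x y)))
                        (Σʷ-sift x (λ y → f (b ∷ y)))

  nbrsIn≡adj : (C : Code q n) (j : ℕ) (x : Word q n) → + nbrsIn C j x ≡ adj (λ y → 𝟙 (distC C y ≟ j)) x
  nbrsIn≡adj {n} C j x = begin
    + nbrsIn C j x
      ≡⟨ ∑ˡ-count (λ y → (dist x y ≟ 1) ×-dec (distC C y ≟ j)) (allWords q n) ⟩
    ∑ˡ (allWords q n) (λ y → 𝟙 ((dist x y ≟ 1) ×-dec (distC C y ≟ j)))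
      ≡⟨ ∑ˡ-allWords (λ y → 𝟙 ((dist x y ≟ 1) ×-dec (distC C y ≟ j))) ⟩
    Σʷ (λ y → 𝟙 ((dist x y ≟ 1) ×-dec (distC C y ≟ j)))
      ≡⟨ Σʷ-cong (λ y → 𝟙-×-dec (dist x y ≟ 1) (distC C y ≟ j)) ⟩
    Σʷ (λ y → sphere 1 x y * 𝟙 (distC C y ≟ j))
      ≡⟨ adj-neighbours (λ y → 𝟙 (distC C y ≟ j)) x ⟨
    adj (λ y → 𝟙 (distC C y ≟ j)) x
      ∎

  adj-sphere₀ : (c x : Word q n) → adj (sphere 0 c) x ≡ sphere 1 c x
  adj-sphere₀ c x = begin
    adj (sphere 0 c) x                      ≡⟨ adj-neighbours (sphere 0 c) x ⟩
    Σʷ (λ y → sphere 1 x y * sphere 0 c y)  ≡⟨ Σʷ-cong (λ y → *-comm (sphere 1 x y) (sphere 0 c y)) ⟩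
    Σʷ (λ y → sphere 0 c y * sphere 1 x y)  ≡⟨ Σʷ-sift c (sphere 1 x) ⟩
    sphere 1 x c                            ≡⟨ sphere-sym 1 x c ⟩
    sphere 1 c x                            ∎

  adj-sphere₁ : (c x : Word q n) →
    adj (sphere 1 c) x ≡ K n * sphere 0 c x + (+ q - + 2) * sphere 1 c x + + 2 * sphere 2 c x
  adj-sphere₁ [] [] = vanish (+ q)
    where vanish : ∀ q → 0ℤ ≡ 0ℤ * 1ℤ + (q - + 2) * 0ℤ + + 2 * 0ℤ
          vanish = solve-∀
  adj-sphere₁ {suc n} (a ∷ c) (b ∷ x) = by-cases (a Fin.≟ b)
    where
    s₀ s₁ s₂ : ℤ
    s₀ = sphere 0 c x
    s₁ = sphere 1 c x
    s₂ = sphere 2 c x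
    rhs : ℕ → ℤ
    rhs d = K (suc n) * 𝟙 (d ≟ 0) + (+ q - + 2) * 𝟙 (d ≟ 1) + + 2 * 𝟙 (d ≟ 2)
    unfold : adj (sphere 1 (a ∷ c)) (b ∷ x)
           ≡ adj (λ y → sphere 1 (a ∷ c) (b ∷ y)) x + (+ q * s₀ + (s₁ - s₀) - sphere 1 (a ∷ c) (b ∷ x))
    unfold = cong (λ t → adj (λ y → sphere 1 (a ∷ c) (b ∷ y)) x + (t - sphere 1 (a ∷ c) (b ∷ x)))
                  (∑-sphere-∷ 0 a c x)
    by-cases : Dec (a ≡ b) → adj (sphere 1 (a ∷ c)) (b ∷ x) ≡ rhs (dist (a ∷ c) (b ∷ x))
    by-cases (yes refl) = begin
      adj (sphere 1 (a ∷ c)) (a ∷ x)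
        ≡⟨ unfold ⟩
      adj (λ y → sphere 1 (a ∷ c) (a ∷ y)) x + (+ q * s₀ + (s₁ - s₀) - sphere 1 (a ∷ c) (a ∷ x))
        ≡⟨ cong₂ (λ t u → t + (+ q * s₀ + (s₁ - s₀) - u))
                 (trans (adj-cong (sphere-∷-≡ 1 a c) x) (adj-sphere₁ c x)) (sphere-∷-≡ 1 a c x) ⟩
      K n * s₀ + (+ q - + 2) * s₁ + + 2 * s₂ + (+ q * s₀ + (s₁ - s₀) - s₁)
        ≡⟨ same-letter (+ n) (+ q) s₀ s₁ s₂ ⟩
      K (suc n) * s₀ + (+ q - + 2) * s₁ + + 2 * s₂
        ≡⟨ cong rhs (dist-∷-≡ a c x) ⟨
      rhs (dist (a ∷ c) (a ∷ x))
        ∎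
      where same-letter : ∀ n q s₀ s₁ s₂ →
              n * (q - 1ℤ) * s₀ + (q - + 2) * s₁ + + 2 * s₂ + (q * s₀ + (s₁ - s₀) - s₁)
              ≡ (1ℤ + n) * (q - 1ℤ) * s₀ + (q - + 2) * s₁ + + 2 * s₂
            same-letter = solve-∀
    by-cases (no a≢b) = begin
      adj (sphere 1 (a ∷ c)) (b ∷ x)
        ≡⟨ unfold ⟩
      adj (λ y → sphere 1 (a ∷ c) (b ∷ y)) x + (+ q * s₀ + (s₁ - s₀) - sphere 1 (a ∷ c) (b ∷ x))
        ≡⟨ cong₂ (λ t u → t + (+ q * s₀ + (s₁ - s₀) - u))
                 (trans (adj-cong (sphere-∷-≢ 0 a≢b c) x) (adj-sphere₀ c x)) (sphere-∷-≢ 0 a≢b c x) ⟩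
      s₁ + (+ q * s₀ + (s₁ - s₀) - s₀)
        ≡⟨ other-letter (K (suc n)) (+ q) s₀ s₁ ⟩
      K (suc n) * 0ℤ + (+ q - + 2) * s₀ + + 2 * s₁
        ≡⟨ cong rhs (dist-∷-≢ a≢b c x) ⟨
      rhs (dist (a ∷ c) (b ∷ x))
        ∎
      where other-letter : ∀ k q s₀ s₁ →
              s₁ + (q * s₀ + (s₁ - s₀) - s₀) ≡ k * 0ℤ + (q - + 2) * s₀ + + 2 * s₁
            other-letter = solve-∀

  Σʷ-sphere₁ : (c : Word q n) → Σʷ (sphere 1 c) ≡ K n
  Σʷ-sphere₁ {n} c = begin
    Σʷ (sphere 1 c)               ≡⟨ Σʷ-cong (λ y → sym (*-identityʳ (sphere 1 c y))) ⟩
    Σʷ (λ y → sphere 1 c y * 1ℤ)  ≡⟨ adj-neighbours (λ _ → 1ℤ) c ⟨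
    adj (λ _ → 1ℤ) c              ≡⟨ adj-const 1ℤ c ⟩
    K n * 1ℤ                      ≡⟨ *-identityʳ (K n) ⟩
    K n                           ∎

  -- On the eigenspace of adj with eigenvalue K n - q i, M a acts as q (a - i), so the form Ψ a has
  -- eigenvalues q² (a - 1 - i) (a - i) ≥ 0.
  M : ℤ → (Word q n → ℤ) → Word q n → ℤ
  M {n} a u x = adj u x + (+ q * a - K n) * u x

  Ψ : ℤ → (Word q n → ℤ) → ℤ
  Ψ a u = ⟪ M (a - 1ℤ) u , M a u ⟫

  M-cong : ∀ a {f g : Word q n → ℤ} → (∀ y → f y ≡ g y) → ∀ x → M a f x ≡ M a g x
  M-cong {n} a f≗g x = cong₂ _+_ (adj-cong f≗g x) (cong ((+ q * a - K n) *_) (f≗g x))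

  M-zero : ∀ a (x : Word q n) → M a (λ _ → 0ℤ) x ≡ 0ℤ
  M-zero {n} a x = cong₂ _+_ (adj-zero x) (*-zeroʳ (+ q * a - K n))

  M-∑ : ∀ {k} a (w : Fin k → Word q n → ℤ) x →
        ∑[ i < k ] M a (w i) x ≡ M a (λ y → ∑[ i < k ] w i y) x
  M-∑ {n} {k} a w x = begin
    ∑[ i < k ] (adj (w i) x + c * w i x)
      ≡⟨ ∑-distrib-+ (λ i → adj (w i) x) (λ i → c * w i x) ⟩
    ∑[ i < k ] adj (w i) x + ∑[ i < k ] (c * w i x)
      ≡⟨ cong₂ _+_ (adj-∑ w x) (*-distribˡ-sum c (λ i → w i x)) ⟨
    adj (λ y → ∑[ i < k ] w i y) x + c * ∑[ i < k ] w i x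
      ∎
    where c : ℤ
          c = + q * a - K n

  headSum : (Word q (suc n) → ℤ) → Word q n → ℤ
  headSum u x = ∑[ b < q ] u (b ∷ x)

  headDeviation : (Word q (suc n) → ℤ) → Fin q → Word q n → ℤ
  headDeviation u b x = + q * u (b ∷ x) - headSum u x

  ∑-headDeviation : (u : Word q (suc n) → ℤ) (x : Word q n) → ∑[ b < q ] headDeviation u b x ≡ 0ℤ
  ∑-headDeviation u x = begin
    ∑[ b < q ] (+ q * u (b ∷ x) - s)
      ≡⟨ ∑-distrib-+ (λ b → + q * u (b ∷ x)) (λ _ → - s) ⟩
    ∑[ b < q ] (+ q * u (b ∷ x)) + ∑[ b < q ] (- s)
      ≡⟨ cong₂ _+_ (*-distribˡ-sum (+ q) (λ b → u (b ∷ x))) (sym (∑-const q (- s))) ⟨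
    + q * s + + q * - s
      ≡⟨ cancel (+ q) s ⟩
    0ℤ
      ∎
    where s : ℤ
          s = headSum u x
          cancel : ∀ q s → q * s + q * - s ≡ 0ℤ
          cancel = solve-∀

  -- The zero-sum deviations along the first letter lie one eigenspace higher than the head sum.
  M-split : ∀ a (u : Word q (suc n) → ℤ) b x →
            + q * M a u (b ∷ x) ≡ M a (headSum u) x + M (a - 1ℤ) (headDeviation u b) x
  M-split {n} a u b x = begin
    + q * M a u (b ∷ x)
      ≡⟨ expand (+ q) (+ n) a (adj uᵇ x) (adj s x) (s x) (uᵇ x) ⟩
    adj s x + (+ q * a - K n) * s x + (+ q * adj uᵇ x - adj s x + (+ q * (a - 1ℤ) - K n) * w x)
      ≡⟨ cong (λ t → adj s x + (+ q * a - K n) * s x + (t + (+ q * (a - 1ℤ) - K n) * w x)) adj-w ⟨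
    M a s x + M (a - 1ℤ) w x
      ∎
    where
    uᵇ s w : Word q n → ℤ
    uᵇ y = u (b ∷ y)
    s    = headSum u
    w    = headDeviation u b
    adj-w : adj w x ≡ + q * adj uᵇ x - adj s x
    adj-w = trans (adj-- (λ y → + q * uᵇ y) s x) (cong (_- adj s x) (adj-* (+ q) uᵇ x))
    expand : ∀ q n a Aᵇ Aˢ S U →
      q * (Aᵇ + (S - U) + (q * a - (1ℤ + n) * (q - 1ℤ)) * U)
      ≡ Aˢ + (q * a - n * (q - 1ℤ)) * S + (q * Aᵇ - Aˢ + (q * (a - 1ℤ) - n * (q - 1ℤ)) * (q * U - S))
    expand = solve-∀

  ∑-M-headDeviation : ∀ c (u : Word q (suc n) → ℤ) x → ∑[ b < q ] M c (headDeviation u b) x ≡ 0ℤ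
  ∑-M-headDeviation c u x =
    trans (M-∑ c (headDeviation u) x) (trans (M-cong c (∑-headDeviation u) x) (M-zero c x))

  Ψ-split : ∀ a (u : Word q (suc n) → ℤ) →
            + q * + q * Ψ a u ≡ + q * Ψ a (headSum u) + ∑[ b < q ] Ψ (a - 1ℤ) (headDeviation u b)
  Ψ-split {n} a u = begin
    + q * + q * Ψ a u
      ≡⟨ *-distribˡ-sum (+ q * + q) (λ b → Σʷ (λ x → m b x * m′ b x)) ⟩
    ∑[ b < q ] (+ q * + q * Σʷ (λ x → m b x * m′ b x))
      ≡⟨ ∑-cong (λ b → trans (*-distribˡ-Σʷ (+ q * + q) (λ x → m b x * m′ b x))
                              (Σʷ-cong (pointwise b))) ⟩
    ∑[ b < q ] Σʷ (λ x → P x * P′ x + R b x * R′ b x + (P x * R′ b x + P′ x * R b x))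
      ≡⟨ ∑-cong (λ b → trans (Σʷ-distrib-+ (λ x → P x * P′ x + R b x * R′ b x)
                                            (λ x → P x * R′ b x + P′ x * R b x))
                              (cong₂ _+_ (Σʷ-distrib-+ (λ x → P x * P′ x) (λ x → R b x * R′ b x))
                                         (Σʷ-distrib-+ (λ x → P x * R′ b x) (λ x → P′ x * R b x)))) ⟩
    ∑[ b < q ] (⟪ P , P′ ⟫ + ⟪ R b , R′ b ⟫ + (⟪ P , R′ b ⟫ + ⟪ P′ , R b ⟫))
      ≡⟨ trans (∑-distrib-+ (λ b → ⟪ P , P′ ⟫ + ⟪ R b , R′ b ⟫)
                            (λ b → ⟪ P , R′ b ⟫ + ⟪ P′ , R b ⟫))
               (cong₂ _+_ (∑-distrib-+ (λ _ → ⟪ P , P′ ⟫) (λ b → ⟪ R b , R′ b ⟫))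
                          (∑-distrib-+ (λ b → ⟪ P , R′ b ⟫) (λ b → ⟪ P′ , R b ⟫))) ⟩
    ∑[ b < q ] ⟪ P , P′ ⟫ + ∑[ b < q ] ⟪ R b , R′ b ⟫
      + (∑[ b < q ] ⟪ P , R′ b ⟫ + ∑[ b < q ] ⟪ P′ , R b ⟫)
      ≡⟨ cong₂ _+_ (cong (_+ ∑[ b < q ] ⟪ R b , R′ b ⟫) (∑-const q ⟪ P , P′ ⟫))
                   (cong₂ _+_ (∑-⟪⟫-orthogonal P R′ (∑-M-headDeviation (a - 1ℤ) u))
                              (∑-⟪⟫-orthogonal P′ R (∑-M-headDeviation (a - 1ℤ - 1ℤ) u))) ⟩
    + q * ⟪ P , P′ ⟫ + ∑[ b < q ] ⟪ R b , R′ b ⟫ + 0ℤ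
      ≡⟨ +-identityʳ _ ⟩
    + q * Ψ a (headSum u) + ∑[ b < q ] Ψ (a - 1ℤ) (headDeviation u b)
      ∎
    where
    m m′ R R′ : Fin q → Word q n → ℤ
    m  b x = M (a - 1ℤ) u (b ∷ x)
    m′ b x = M a u (b ∷ x)
    R  b   = M (a - 1ℤ - 1ℤ) (headDeviation u b)
    R′ b   = M (a - 1ℤ) (headDeviation u b)
    P P′ : Word q n → ℤ
    P  = M (a - 1ℤ) (headSum u)
    P′ = M a (headSum u)
    interchange : ∀ q m m′ → q * q * (m * m′) ≡ (q * m) * (q * m′)
    interchange = solve-∀
    expand : ∀ p r p′ r′ → (p + r) * (p′ + r′) ≡ p * p′ + r * r′ + (p * r′ + p′ * r)
    expand = solve-∀
    pointwise : ∀ b x → + q * + q * (m b x * m′ b x)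
                        ≡ P x * P′ x + R b x * R′ b x + (P x * R′ b x + P′ x * R b x)
    pointwise b x = begin
      + q * + q * (m b x * m′ b x)     ≡⟨ interchange (+ q) (m b x) (m′ b x) ⟩
      (+ q * m b x) * (+ q * m′ b x)   ≡⟨ cong₂ _*_ (M-split (a - 1ℤ) u b x) (M-split a u b x) ⟩
      (P x + R b x) * (P′ x + R′ b x)  ≡⟨ expand (P x) (R b x) (P′ x) (R′ b x) ⟩
      P x * P′ x + R b x * R′ b x + (P x * R′ b x + P′ x * R b x)
        ∎

  module _ .{{_ : ℕ.NonZero q}} where

    private
      q-cancel : ∀ {i j} → + q * i ≡ + q * j → i ≡ j
      q-cancel = *-cancelˡ-≡ (+ q) _ _

      q-cancel-nonneg : ∀ {i} → 0ℤ ≤ + q * i → 0ℤ ≤ i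
      q-cancel-nonneg {i} 0≤qi = *-cancelˡ-≤-pos 0ℤ i (+ q) {{positive (+<+ (ℕ.>-nonZero⁻¹ q))}}
                                   (subst (_≤ + q * i) (sym (*-zeroʳ (+ q))) 0≤qi)

    headSum-M : ∀ a (u : Word q (suc n) → ℤ) x → headSum (M a u) x ≡ M a (headSum u) x
    headSum-M a u x = q-cancel (begin
      + q * ∑[ b < q ] M a u (b ∷ x)
        ≡⟨ *-distribˡ-sum (+ q) (λ b → M a u (b ∷ x)) ⟩
      ∑[ b < q ] (+ q * M a u (b ∷ x))
        ≡⟨ ∑-cong (λ b → M-split a u b x) ⟩
      ∑[ b < q ] (M a (headSum u) x + M (a - 1ℤ) (headDeviation u b) x)
        ≡⟨ ∑-distrib-+ (λ _ → M a (headSum u) x) (λ b → M (a - 1ℤ) (headDeviation u b) x) ⟩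
      ∑[ b < q ] M a (headSum u) x + ∑[ b < q ] M (a - 1ℤ) (headDeviation u b) x
        ≡⟨ cong₂ _+_ (∑-const q (M a (headSum u) x)) (∑-M-headDeviation (a - 1ℤ) u x) ⟩
      + q * M a (headSum u) x + 0ℤ
        ≡⟨ +-identityʳ _ ⟩
      + q * M a (headSum u) x
        ∎)

    headDeviation-M : ∀ a (u : Word q (suc n) → ℤ) b x →
                      headDeviation (M a u) b x ≡ M (a - 1ℤ) (headDeviation u b) x
    headDeviation-M a u b x = begin
      + q * M a u (b ∷ x) - headSum (M a u) x
        ≡⟨ cong₂ _-_ (M-split a u b x) (headSum-M a u x) ⟩
      M a (headSum u) x + M (a - 1ℤ) (headDeviation u b) x - M a (headSum u) x
        ≡⟨ cancel (M a (headSum u) x) (M (a - 1ℤ) (headDeviation u b) x) ⟩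
      M (a - 1ℤ) (headDeviation u b) x
        ∎
      where cancel : ∀ p r → p + r - p ≡ r
            cancel = solve-∀

    Ψ-nonneg : ∀ a (u : Word q n → ℤ) → 0ℤ ≤ Ψ a u
    Ψ-nonneg {zero}  a u = subst (0ℤ ≤_) (sym (factor (+ q) a (u [])))
                                 (*-nonneg (square-nonneg (+ q * u [])) (consecutive-nonneg a))
      where factor : ∀ q a u → (0ℤ + (q * (a - 1ℤ) - 0ℤ) * u) * (0ℤ + (q * a - 0ℤ) * u)
                               ≡ q * u * (q * u) * ((a - 1ℤ) * a)
            factor = solve-∀
    Ψ-nonneg {suc n} a u = q-cancel-nonneg (q-cancel-nonneg (subst (0ℤ ≤_) split 0≤parts))
      where
      split : + q * Ψ a (headSum u) + ∑[ b < q ] Ψ (a - 1ℤ) (headDeviation u b) ≡ + q * (+ q * Ψ a u)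
      split = trans (sym (Ψ-split a u)) (*-assoc (+ q) (+ q) (Ψ a u))
      0≤parts : 0ℤ ≤ + q * Ψ a (headSum u) + ∑[ b < q ] Ψ (a - 1ℤ) (headDeviation u b)
      0≤parts = +-mono-≤ (*-nonneg {+ q} (+≤+ ℕ.z≤n) (Ψ-nonneg a (headSum u)))
                         (∑-nonneg _ (λ b → Ψ-nonneg (a - 1ℤ) (headDeviation u b)))

    Ψ≡0⇒MM≡0 : ∀ a (u : Word q n → ℤ) → Ψ a u ≡ 0ℤ → ∀ x → M (a - 1ℤ) (M a u) x ≡ 0ℤ
    Ψ≡0⇒MM≡0 {zero} a u Ψ≡0 [] =
      [ id , vanish ]′ (i*j≡0⇒i≡0∨j≡0 (M (a - 1ℤ) (M a u) []) (trans (factor (+ q) a (u [])) Ψ≡0))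
      where
      factor : ∀ q a u → (0ℤ + (q * (a - 1ℤ) - 0ℤ) * (0ℤ + (q * a - 0ℤ) * u)) * u
                         ≡ (0ℤ + (q * (a - 1ℤ) - 0ℤ) * u) * (0ℤ + (q * a - 0ℤ) * u)
      factor = solve-∀
      at-zero : ∀ q a → 0ℤ + (q * (a - 1ℤ) - 0ℤ) * (0ℤ + (q * a - 0ℤ) * 0ℤ) ≡ 0ℤ
      at-zero = solve-∀
      vanish : u [] ≡ 0ℤ → M (a - 1ℤ) (M a u) [] ≡ 0ℤ
      vanish u≡0 = trans (cong (λ t → 0ℤ + (+ q * (a - 1ℤ) - 0ℤ) * (0ℤ + (+ q * a - 0ℤ) * t)) u≡0)
                         (at-zero (+ q) a)
    Ψ≡0⇒MM≡0 {suc n} a u Ψ≡0 (b ∷ x) = q-cancel (begin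
      + q * M (a - 1ℤ) (M a u) (b ∷ x)
        ≡⟨ M-split (a - 1ℤ) (M a u) b x ⟩
      M (a - 1ℤ) (headSum (M a u)) x + M (a - 1ℤ - 1ℤ) (headDeviation (M a u) b) x
        ≡⟨ cong₂ _+_ (M-cong (a - 1ℤ) (headSum-M a u) x) (M-cong (a - 1ℤ - 1ℤ) (headDeviation-M a u b) x) ⟩
      M (a - 1ℤ) (M a (headSum u)) x + M (a - 1ℤ - 1ℤ) (M (a - 1ℤ) (headDeviation u b)) x
        ≡⟨ cong₂ _+_ (Ψ≡0⇒MM≡0 a (headSum u) Ψ-headSum≡0 x)
                     (Ψ≡0⇒MM≡0 (a - 1ℤ) (headDeviation u b) (Ψ-headDeviation≡0 b) x) ⟩
      0ℤ + 0ℤ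
        ≡⟨ *-zeroʳ (+ q) ⟨
      + q * 0ℤ
        ∎)
      where
      parts≡0 : + q * Ψ a (headSum u) ≡ 0ℤ × ∑[ b < q ] Ψ (a - 1ℤ) (headDeviation u b) ≡ 0ℤ
      parts≡0 = +-nonneg-≡0 (*-nonneg {+ q} (+≤+ ℕ.z≤n) (Ψ-nonneg a (headSum u)))
                            (∑-nonneg _ (λ b → Ψ-nonneg (a - 1ℤ) (headDeviation u b)))
                            (trans (sym (Ψ-split a u)) (trans (cong (+ q * + q *_) Ψ≡0) (*-zeroʳ (+ q * + q))))
      Ψ-headSum≡0 : Ψ a (headSum u) ≡ 0ℤ
      Ψ-headSum≡0 = q-cancel (trans (proj₁ parts≡0) (sym (*-zeroʳ (+ q))))
      Ψ-headDeviation≡0 : ∀ b → Ψ (a - 1ℤ) (headDeviation u b) ≡ 0ℤ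
      Ψ-headDeviation≡0 = ∑-nonneg-≡0 _ (λ b → Ψ-nonneg (a - 1ℤ) (headDeviation u b)) (proj₂ parts≡0)

module FilterCounting {A : Set} {P : A → Set} (P? : ∀ x → Dec (P x)) where
  open import Data.List.Membership.Propositional.Properties using (∈-filter⁺; ∈-filter⁻)
  open import Data.List.Relation.Unary.All as All using (All)
  open import Data.List.Relation.Unary.AllPairs using (_∷_)
  open import Data.List.Properties using (filter-none)
  open import Data.Product using (∃)

  count : List A → ℕ
  count xs = length (filter P? xs)

  count≡0 : ∀ {xs} → (∀ {x} → x ∈ xs → ¬ P x) → count xs ≡ 0
  count≡0 none = cong length (filter-none P? (All.tabulate none))

  count≡0⇒¬P : ∀ {xs x} → count xs ≡ 0 → x ∈ xs → ¬ P x
  count≡0⇒¬P {xs} count≡0 x∈xs Px with filter P? xs | ∈-filter⁺ P? x∈xs Px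
  ... | []    | ()
  ... | _ ∷ _ | _  = contradiction count≡0 λ ()

  count≢0⇒∃ : ∀ {xs} → count xs ≢ 0 → ∃ λ x → x ∈ xs × P x
  count≢0⇒∃ {xs} count≢0 with filter P? xs | (λ {y} → ∈-filter⁻ P? {y} {xs})
  ... | []    | _        = contradiction refl count≢0
  ... | x ∷ _ | ∈filter⁻ = x , ∈filter⁻ (here refl)

  count≤1 : ∀ {xs} → Unique xs → (∀ {x y} → x ∈ xs → y ∈ xs → P x → P y → x ≡ y) →
            count xs ℕ.≤ 1
  count≤1 {[]}     _                _        = ℕ.z≤n
  count≤1 {x ∷ xs} (x∉xs ∷ unique) unique-P with P? x
  ... | yes Px = ℕ.s≤s (ℕₚ.≤-reflexive (count≡0 λ y∈xs Py →
                   All.lookup x∉xs y∈xs (unique-P (here refl) (there y∈xs) Px Py)))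
  ... | no _   = count≤1 unique (λ x∈ y∈ → unique-P (there x∈) (there y∈))

module RationalEmbedding where
  open ≡-Reasoning
  open import Data.Integer using (1ℤ)
  import Data.Integer.Properties as ℤₚ
  open import Data.Integer.Tactic.RingSolver using (solve-∀)
  open import Data.Rational using (ℚ; NonZero; _/_; _+_; _*_; 1ℚ; 1/_; toℚᵘ; ≢-nonZero)
  open import Data.Rational.Properties
    using (toℚᵘ-injective; toℚᵘ-cong; toℚᵘ-fromℚᵘ; toℚᵘ-homo-+; toℚᵘ-homo-*; *-inverseˡ)
  open import Data.Rational.Unnormalised using (mkℚᵘ; *≡*; _≃_)
  import Data.Rational.Unnormalised.Properties as ℚᵘₚ
  open import Data.Rational.Solver using (module +-*-Solver)

  ι : ℤ → ℚ
  ι i = i / 1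

  toℚᵘ-ι : ∀ i → toℚᵘ (ι i) ≃ mkℚᵘ i 0
  toℚᵘ-ι i = toℚᵘ-fromℚᵘ (mkℚᵘ i 0)

  ι-+ : ∀ i j → ι (i ℤ.+ j) ≡ ι i + ι j
  ι-+ i j = toℚᵘ-injective
    (ℚᵘₚ.≃-trans (toℚᵘ-ι (i ℤ.+ j)) (ℚᵘₚ.≃-trans (*≡* (sum-form i j)) (ℚᵘₚ.≃-sym
      (ℚᵘₚ.≃-trans (toℚᵘ-homo-+ (ι i) (ι j)) (ℚᵘₚ.+-cong (toℚᵘ-ι i) (toℚᵘ-ι j))))))
    where sum-form : ∀ i j → (i ℤ.+ j) ℤ.* 1ℤ ≡ (i ℤ.* 1ℤ ℤ.+ j ℤ.* 1ℤ) ℤ.* 1ℤ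
          sum-form = solve-∀

  ι-* : ∀ i j → ι (i ℤ.* j) ≡ ι i * ι j
  ι-* i j = toℚᵘ-injective
    (ℚᵘₚ.≃-trans (toℚᵘ-ι (i ℤ.* j)) (ℚᵘₚ.≃-sym
      (ℚᵘₚ.≃-trans (toℚᵘ-homo-* (ι i) (ι j)) (ℚᵘₚ.*-cong (toℚᵘ-ι i) (toℚᵘ-ι j)))))

  ι-injective : ∀ {i j} → ι i ≡ ι j → i ≡ j
  ι-injective {i} {j} ιi≡ιj
    with ℚᵘₚ.≃-trans (ℚᵘₚ.≃-sym (toℚᵘ-ι i))
                    (ℚᵘₚ.≃-trans (toℚᵘ-cong ιi≡ιj) (toℚᵘ-ι j))
  ... | *≡* i*1≡j*1 = trans (sym (ℤₚ.*-identityʳ i)) (trans i*1≡j*1 (ℤₚ.*-identityʳ j))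

  module Rescaled {k : ℤ} (c₀ c₁ c₂ : ℤ) (k≢0 : k ≢ ℤ.0ℤ) where
    private instance
      ιk≢0 : NonZero (ι k)
      ιk≢0 = ≢-nonZero (k≢0 ∘ ι-injective)

    r α₀ α₁ α₂ : ℚ
    r  = 1/ ι k
    α₀ = r * ι c₀
    α₁ = r * ι c₁
    α₂ = r * ι c₂

    rescaled : ∀ a₀ a₁ a₂ → c₀ ℤ.* a₀ ℤ.+ c₁ ℤ.* a₁ ℤ.+ c₂ ℤ.* a₂ ≡ k →
               α₀ * ι a₀ + α₁ * ι a₁ + α₂ * ι a₂ ≡ 1ℚ
    rescaled a₀ a₁ a₂ relation = begin
      r * ι c₀ * ι a₀ + r * ι c₁ * ι a₁ + r * ι c₂ * ι a₂
        ≡⟨ regroup r (ι c₀) (ι c₁) (ι c₂) (ι a₀) (ι a₁) (ι a₂) ⟩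
      r * (ι c₀ * ι a₀ + ι c₁ * ι a₁ + ι c₂ * ι a₂)
        ≡⟨ cong (r *_) (cong₂ _+_ (cong₂ _+_ (ι-* c₀ a₀) (ι-* c₁ a₁)) (ι-* c₂ a₂)) ⟨
      r * (ι (c₀ ℤ.* a₀) + ι (c₁ ℤ.* a₁) + ι (c₂ ℤ.* a₂))
        ≡⟨ cong (r *_) (trans (ι-+ (c₀ ℤ.* a₀ ℤ.+ c₁ ℤ.* a₁) (c₂ ℤ.* a₂))
                              (cong (_+ ι (c₂ ℤ.* a₂)) (ι-+ (c₀ ℤ.* a₀) (c₁ ℤ.* a₁)))) ⟨
      r * ι (c₀ ℤ.* a₀ ℤ.+ c₁ ℤ.* a₁ ℤ.+ c₂ ℤ.* a₂)
        ≡⟨ cong (λ t → r * ι t) relation ⟩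
      r * ι k
        ≡⟨ *-inverseˡ (ι k) ⟩
      1ℚ
        ∎
      where
      open +-*-Solver
      regroup : ∀ r x y z a b c → r * x * a + r * y * b + r * z * c ≡ r * (x * a + y * b + z * c)
      regroup = solve 7 (λ r x y z a b c → r :* x :* a :+ r :* y :* b :+ r :* z :* c
                                           := r :* (x :* a :+ y :* b :+ z :* c)) refl

module OneErrorCorrectingCode
  (q n : ℕ) (C : Code q n) (unique : Unique C)
  (separated : ∀ {c c′} → c ∈ C → c′ ∈ C → c ≢ c′ → 3 ℕ.≤ dist c c′)
  where

  open ≡-Reasoning
  open import Data.Integer hiding (suc; _≟_)
  open import Data.Integer.Properties hiding (_≟_)
  open import Data.Integer.Tactic.RingSolver using (solve-∀)
  open import Data.Nat using (_≟_)
  open import Data.Vec.Properties using (≡-dec)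
  open Integers
  open HammingGraph q
  open FilterCounting

  𝟙C : Word q n → ℤ
  𝟙C y = + A C 0 y

  A≡∑ˡ-sphere : ∀ i y → + A C i y ≡ ∑ˡ C (λ c → sphere i c y)
  A≡∑ˡ-sphere i y = trans (∑ˡ-count (λ c → dist y c ≟ i) C) (∑-cong (λ k → sphere-sym i y (lookup C k)))

  adj-𝟙C : ∀ x → adj 𝟙C x ≡ + A C 1 x
  adj-𝟙C x = begin
    adj 𝟙C x                                 ≡⟨ adj-cong (A≡∑ˡ-sphere 0) x ⟩
    adj (λ y → ∑ˡ C (λ c → sphere 0 c y)) x  ≡⟨ adj-∑ (λ k → sphere 0 (lookup C k)) x ⟩
    ∑ˡ C (λ c → adj (sphere 0 c) x)          ≡⟨ ∑-cong (λ k → adj-sphere₀ (lookup C k) x) ⟩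
    ∑ˡ C (λ c → sphere 1 c x)                ≡⟨ A≡∑ˡ-sphere 1 x ⟨
    + A C 1 x                                ∎

  adj²-𝟙C : ∀ x → adj (adj 𝟙C) x ≡ K n * + A C 0 x + (+ q - + 2) * + A C 1 x + + 2 * + A C 2 x
  adj²-𝟙C x = begin
    adj (adj 𝟙C) x
      ≡⟨ adj-cong (λ y → trans (adj-𝟙C y) (A≡∑ˡ-sphere 1 y)) x ⟩
    adj (λ y → ∑ˡ C (λ c → sphere 1 c y)) x
      ≡⟨ adj-∑ (λ k → sphere 1 (lookup C k)) x ⟩
    ∑ˡ C (λ c → adj (sphere 1 c) x)
      ≡⟨ ∑-cong (λ k → adj-sphere₁ (lookup C k) x) ⟩
    ∑ˡ C (λ c → K n * s₀ c + (+ q - + 2) * s₁ c + + 2 * s₂ c)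
      ≡⟨ ∑-distrib-+ (λ k → K n * s₀ (lookup C k) + (+ q - + 2) * s₁ (lookup C k))
                     (λ k → + 2 * s₂ (lookup C k)) ⟩
    ∑ˡ C (λ c → K n * s₀ c + (+ q - + 2) * s₁ c) + ∑ˡ C (λ c → + 2 * s₂ c)
      ≡⟨ cong (_+ ∑ˡ C (λ c → + 2 * s₂ c))
              (∑-distrib-+ (λ k → K n * s₀ (lookup C k)) (λ k → (+ q - + 2) * s₁ (lookup C k))) ⟩
    ∑ˡ C (λ c → K n * s₀ c) + ∑ˡ C (λ c → (+ q - + 2) * s₁ c) + ∑ˡ C (λ c → + 2 * s₂ c)
      ≡⟨ cong₂ _+_ (cong₂ _+_ (*-distribˡ-sum (K n) (s₀ ∘ lookup C))
                              (*-distribˡ-sum (+ q - + 2) (s₁ ∘ lookup C)))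
                   (*-distribˡ-sum (+ 2) (s₂ ∘ lookup C)) ⟨
    K n * ∑ˡ C s₀ + (+ q - + 2) * ∑ˡ C s₁ + + 2 * ∑ˡ C s₂
      ≡⟨ cong₂ _+_ (cong₂ _+_ (cong (K n *_) (A≡∑ˡ-sphere 0 x))
                              (cong ((+ q - + 2) *_) (A≡∑ˡ-sphere 1 x)))
                   (cong (+ 2 *_) (A≡∑ˡ-sphere 2 x)) ⟨
    K n * + A C 0 x + (+ q - + 2) * + A C 1 x + + 2 * + A C 2 x
      ∎
    where
    s₀ s₁ s₂ : Word q n → ℤ
    s₀ c = sphere 0 c x
    s₁ c = sphere 1 c x
    s₂ c = sphere 2 c x

  Σʷ-𝟙C : Σʷ 𝟙C ≡ + length C
  Σʷ-𝟙C = begin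
    Σʷ 𝟙C                                 ≡⟨ Σʷ-cong (A≡∑ˡ-sphere 0) ⟩
    Σʷ (λ y → ∑ˡ C (λ c → sphere 0 c y))  ≡⟨ ∑-comm-Σʷ (λ k → sphere 0 (lookup C k)) ⟨
    ∑ˡ C (λ c → Σʷ (sphere 0 c))          ≡⟨ ∑-cong (λ k → Σʷ-sphere₀ (lookup C k)) ⟩
    ∑[ k < length C ] 1ℤ                  ≡⟨ ∑-const (length C) 1ℤ ⟩
    + length C * 1ℤ                       ≡⟨ *-identityʳ (+ length C) ⟩
    + length C                            ∎
    where Σʷ-sphere₀ : ∀ c → Σʷ (sphere 0 c) ≡ 1ℤ
          Σʷ-sphere₀ c = trans (Σʷ-cong (λ y → sym (*-identityʳ (sphere 0 c y)))) (Σʷ-sift c (λ _ → 1ℤ))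

  Σʷ-adj-𝟙C : Σʷ (adj 𝟙C) ≡ K n * + length C
  Σʷ-adj-𝟙C = begin
    Σʷ (adj 𝟙C)                           ≡⟨ Σʷ-cong (λ y → trans (adj-𝟙C y) (A≡∑ˡ-sphere 1 y)) ⟩
    Σʷ (λ y → ∑ˡ C (λ c → sphere 1 c y))  ≡⟨ ∑-comm-Σʷ (λ k → sphere 1 (lookup C k)) ⟨
    ∑ˡ C (λ c → Σʷ (sphere 1 c))          ≡⟨ ∑-cong (λ k → Σʷ-sphere₁ (lookup C k)) ⟩
    ∑[ k < length C ] K n                 ≡⟨ ∑-const (length C) (K n) ⟩
    + length C * K n                      ≡⟨ *-comm (+ length C) (K n) ⟩
    K n * + length C                      ∎

  close⇒≡ : ∀ {c c′} → c ∈ C → c′ ∈ C → dist c c′ ℕ.≤ 2 → c ≡ c′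
  close⇒≡ {c} {c′} c∈C c′∈C d≤2 with ≡-dec Fin._≟_ c c′
  ... | yes c≡c′ = c≡c′
  ... | no c≢c′  = contradiction (separated c∈C c′∈C c≢c′) (ℕₚ.<⇒≱ (ℕ.s≤s d≤2))

  A₀≤1 : ∀ y → A C 0 y ℕ.≤ 1
  A₀≤1 y = count≤1 (λ c → dist y c ≟ 0) unique
             (λ {c} {c′} _ _ d₀ d₀′ → trans (sym (dist≡0⇒≡ y c d₀)) (dist≡0⇒≡ y c′ d₀′))

  A₁≤1 : ∀ y → A C 1 y ℕ.≤ 1
  A₁≤1 y = count≤1 (λ c → dist y c ≟ 1) unique λ {c} {c′} c∈C c′∈C d₁ d₁′ →
    close⇒≡ c∈C c′∈C (ℕₚ.≤-trans (dist-triangle c y c′)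
                                 (ℕₚ.≤-reflexive (cong₂ ℕ._+_ (trans (dist-sym c y) d₁) d₁′)))

  A₀≢0⇒A₁≡0 : ∀ y → A C 0 y ≢ 0 → A C 1 y ≡ 0
  A₀≢0⇒A₁≡0 y A₀≢0 with count≢0⇒∃ (λ c → dist y c ≟ 0) A₀≢0
  ... | c , c∈C , d₀ = count≡0 (λ c → dist y c ≟ 1) not-adjacent
    where
    not-adjacent : ∀ {c′} → c′ ∈ C → dist y c′ ≢ 1
    not-adjacent {c′} c′∈C d₁ = contradiction (trans (sym d₀) (trans (cong (dist y) c≡c′) d₁)) λ ()
      where
      c≡c′ : c ≡ c′
      c≡c′ = close⇒≡ c∈C c′∈C (subst (λ z → dist z c′ ℕ.≤ 2) (dist≡0⇒≡ y c d₀)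
                                     (ℕₚ.≤-trans (ℕₚ.≤-reflexive d₁) (ℕ.s≤s ℕ.z≤n)))

  data Position (y : Word q n) : Set where
    codeword : A C 0 y ≡ 1 → A C 1 y ≡ 0 → Position y
    adjacent : A C 0 y ≡ 0 → A C 1 y ≡ 1 → Position y
    far      : A C 0 y ≡ 0 → A C 1 y ≡ 0 → Position y

  position : ∀ y → Position y
  position y with A C 0 y in A₀≡ | A C 1 y in A₁≡ | A₀≤1 y | A₁≤1 y
  ... | 0           | 0           | _        | _        = far A₀≡ A₁≡
  ... | 0           | 1           | _        | _        = adjacent A₀≡ A₁≡
  ... | 1           | 0           | _        | _        = codeword A₀≡ A₁≡
  ... | 1           | 1           | _        | _        =
    contradiction (trans (sym A₁≡) (A₀≢0⇒A₁≡0 y (ℕₚ.1+n≢0 ∘ trans (sym A₀≡)))) ℕₚ.1+n≢0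
  ... | suc (suc _) | _           | ℕ.s≤s () | _
  ... | _           | suc (suc _) | _        | ℕ.s≤s ()

  excess : Word q n → ℤ
  excess x = adj 𝟙C x + + q * 𝟙C x - 1ℤ

  adj𝟙C*excess≡0 : ∀ y → adj 𝟙C y * excess y ≡ 0ℤ
  adj𝟙C*excess≡0 y = trans (cong (λ t → t * (t + + q * 𝟙C y - 1ℤ)) (adj-𝟙C y)) (by-position (position y))
    where
    at-adjacent : ∀ q → 1ℤ * (1ℤ + q * 0ℤ - 1ℤ) ≡ 0ℤ
    at-adjacent = solve-∀
    by-position : Position y → + A C 1 y * (+ A C 1 y + + q * + A C 0 y - 1ℤ) ≡ 0ℤ
    by-position (codeword _ A₁≡0)     rewrite A₁≡0        = refl
    by-position (adjacent A₀≡0 A₁≡1) rewrite A₀≡0 | A₁≡1 = at-adjacent (+ q)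
    by-position (far _ A₁≡0)          rewrite A₁≡0        = refl

module ShortenedPerfectLike
  (q n : ℕ) (2≤q : 2 ℕ.≤ q) (2≤n : 2 ℕ.≤ n)
  (C : Code q n) (unique : Unique C)
  (separated : ∀ {c c′} → c ∈ C → c′ ∈ C → c ≢ c′ → 3 ℕ.≤ dist c c′)
  (a : ℤ) (K≡qa : HammingGraph.K q n ≡ + q ℤ.* a)
  (size : (HammingGraph.K q n ℤ.+ + q) ℤ.* + length C ≡ + (q ℕ.^ n))
  where

  open ≡-Reasoning
  open import Data.Integer hiding (suc; _≟_)
  open import Data.Integer.Properties hiding (_≟_)
  open import Data.Integer.Tactic.RingSolver using (solve-∀)
  open import Data.Nat using (_≟_)
  open Integers
  open HammingGraph q
  open FilterCounting
  open OneErrorCorrectingCode q n C unique separated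

  private instance
    q≢0 : ℕ.NonZero q
    q≢0 = ℕ.>-nonZero (ℕₚ.<-≤-trans (ℕ.s≤s ℕ.z≤n) 2≤q)

  Q : ℤ
  Q = K n + + q

  Q≢0 : Q ≢ 0ℤ
  Q≢0 Q≡0 = ℕ.≢-nonZero⁻¹ (q ℕ.^ n) {{ℕₚ.m^n≢0 q n}} (+-injective qⁿ≡0)
    where qⁿ≡0 : + (q ℕ.^ n) ≡ 0ℤ
          qⁿ≡0 = trans (sym size) (cong (_* + length C) Q≡0)

  M-below : ∀ (f : Word q n → ℤ) x → M (a + 1ℤ - 1ℤ) f x ≡ adj f x
  M-below f x = begin
    adj f x + (+ q * (a + 1ℤ - 1ℤ) - K n) * f x
      ≡⟨ cong (λ k → adj f x + (+ q * (a + 1ℤ - 1ℤ) - k) * f x) K≡qa ⟩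
    adj f x + (+ q * (a + 1ℤ - 1ℤ) - + q * a) * f x
      ≡⟨ vanish (adj f x) (+ q) a (f x) ⟩
    adj f x
      ∎
    where vanish : ∀ A q a f → A + (q * (a + 1ℤ - 1ℤ) - q * a) * f ≡ A
          vanish = solve-∀

  M-above : ∀ (f : Word q n → ℤ) x → M (a + 1ℤ) f x ≡ adj f x + + q * f x
  M-above f x = begin
    adj f x + (+ q * (a + 1ℤ) - K n) * f x
      ≡⟨ cong (λ k → adj f x + (+ q * (a + 1ℤ) - k) * f x) K≡qa ⟩
    adj f x + (+ q * (a + 1ℤ) - + q * a) * f x
      ≡⟨ shift (adj f x) (+ q) a (f x) ⟩
    adj f x + + q * f x
      ∎
    where shift : ∀ A q a f → A + (q * (a + 1ℤ) - q * a) * f ≡ A + q * f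
          shift = solve-∀

  balanced : Word q n → ℤ
  balanced y = Q * 𝟙C y - 1ℤ

  adj-balanced : ∀ x → adj balanced x ≡ Q * adj 𝟙C x - K n
  adj-balanced x = begin
    adj balanced x
      ≡⟨ adj-- (λ y → Q * 𝟙C y) (λ _ → 1ℤ) x ⟩
    adj (λ y → Q * 𝟙C y) x - adj (λ _ → 1ℤ) x
      ≡⟨ cong₂ _-_ (adj-* Q 𝟙C x) (trans (adj-const 1ℤ x) (*-identityʳ (K n))) ⟩
    Q * adj 𝟙C x - K n
      ∎

  Σʷ-excess : Σʷ excess ≡ 0ℤ
  Σʷ-excess = begin
    Σʷ excess
      ≡⟨ Σʷ-distrib-+ (λ x → adj 𝟙C x + + q * 𝟙C x) (λ _ → -1ℤ) ⟩
    Σʷ (λ x → adj 𝟙C x + + q * 𝟙C x) + Σʷ {n} (λ _ → -1ℤ)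
      ≡⟨ cong₂ _+_ (trans (Σʷ-distrib-+ (adj 𝟙C) (λ x → + q * 𝟙C x))
                          (cong (_+_ (Σʷ (adj 𝟙C))) (sym (*-distribˡ-Σʷ (+ q) 𝟙C))))
                   (Σʷ-const n -1ℤ) ⟩
    Σʷ (adj 𝟙C) + + q * Σʷ 𝟙C + + (q ℕ.^ n) * -1ℤ
      ≡⟨ cong₂ (λ s t → s + + q * t + + (q ℕ.^ n) * -1ℤ) Σʷ-adj-𝟙C Σʷ-𝟙C ⟩
    K n * + length C + + q * + length C + + (q ℕ.^ n) * -1ℤ
      ≡⟨ cong (λ t → K n * + length C + + q * + length C + t * -1ℤ) size ⟨
    K n * + length C + + q * + length C + Q * + length C * -1ℤ
      ≡⟨ cancel (K n) (+ q) (+ length C) ⟩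
    0ℤ
      ∎
    where cancel : ∀ K q L → K * L + q * L + (K + q) * L * -1ℤ ≡ 0ℤ
          cancel = solve-∀

  Ψ-balanced : Ψ (a + 1ℤ) balanced ≡ 0ℤ
  Ψ-balanced = begin
    Σʷ (λ x → M (a + 1ℤ - 1ℤ) balanced x * M (a + 1ℤ) balanced x)  ≡⟨ Σʷ-cong pointwise ⟩
    Σʷ (λ x → - (Q * K n) * excess x)                              ≡⟨ *-distribˡ-Σʷ (- (Q * K n)) excess ⟨
    - (Q * K n) * Σʷ excess                                        ≡⟨ cong (- (Q * K n) *_) Σʷ-excess ⟩
    - (Q * K n) * 0ℤ                                               ≡⟨ *-zeroʳ (- (Q * K n)) ⟩
    0ℤ                                                             ∎
    where
    expand : ∀ K q A v → ((K + q) * A - K) * ((K + q) * A - K + q * ((K + q) * v - 1ℤ))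
                         ≡ (K + q) * (K + q) * (A * (A + q * v - 1ℤ)) + - ((K + q) * K) * (A + q * v - 1ℤ)
    expand = solve-∀
    pointwise : ∀ x → M (a + 1ℤ - 1ℤ) balanced x * M (a + 1ℤ) balanced x ≡ - (Q * K n) * excess x
    pointwise x = begin
      M (a + 1ℤ - 1ℤ) balanced x * M (a + 1ℤ) balanced x
        ≡⟨ cong₂ _*_ (M-below balanced x) (M-above balanced x) ⟩
      adj balanced x * (adj balanced x + + q * balanced x)
        ≡⟨ cong (λ t → t * (t + + q * balanced x)) (adj-balanced x) ⟩
      (Q * adj 𝟙C x - K n) * (Q * adj 𝟙C x - K n + + q * balanced x)
        ≡⟨ expand (K n) (+ q) (adj 𝟙C x) (𝟙C x) ⟩
      Q * Q * (adj 𝟙C x * excess x) + - (Q * K n) * excess x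
        ≡⟨ cong (λ t → Q * Q * t + - (Q * K n) * excess x) (adj𝟙C*excess≡0 x) ⟩
      Q * Q * 0ℤ + - (Q * K n) * excess x
        ≡⟨ cong (_+ - (Q * K n) * excess x) (*-zeroʳ (Q * Q)) ⟩
      0ℤ + - (Q * K n) * excess x
        ≡⟨ +-identityˡ _ ⟩
      - (Q * K n) * excess x
        ∎

  adj[adj+q]𝟙C≡K : ∀ x → adj (adj 𝟙C) x + + q * adj 𝟙C x ≡ K n
  adj[adj+q]𝟙C≡K x =
    i-j≡0⇒i≡j _ _ (*-cancelˡ-≡ Q _ 0ℤ {{≢-nonZero Q≢0}} (trans Q*gap≡0 (sym (*-zeroʳ Q))))
    where
    g : Word q n → ℤ
    g y = adj 𝟙C y + + q * 𝟙C y
    regroup : ∀ K q A v → (K + q) * A - K + q * ((K + q) * v - 1ℤ) ≡ (K + q) * (A + q * v) - (K + q)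
    regroup = solve-∀
    shape : ∀ y → adj balanced y + + q * balanced y ≡ Q * g y - Q
    shape y = trans (cong (_+ + q * balanced y) (adj-balanced y)) (regroup (K n) (+ q) (adj 𝟙C y) (𝟙C y))
    distrib : ∀ Q s k → Q * (s - k) ≡ Q * s - k * Q
    distrib = solve-∀
    Q*gap≡0 : Q * (adj (adj 𝟙C) x + + q * adj 𝟙C x - K n) ≡ 0ℤ
    Q*gap≡0 = begin
      Q * (adj (adj 𝟙C) x + + q * adj 𝟙C x - K n)
        ≡⟨ distrib Q (adj (adj 𝟙C) x + + q * adj 𝟙C x) (K n) ⟩
      Q * (adj (adj 𝟙C) x + + q * adj 𝟙C x) - K n * Q
        ≡⟨ cong (λ t → Q * t - K n * Q) (trans (adj-+ (adj 𝟙C) (λ y → + q * 𝟙C y) x)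
                                               (cong (_+_ (adj (adj 𝟙C) x)) (adj-* (+ q) 𝟙C x))) ⟨
      Q * adj g x - K n * Q
        ≡⟨ cong₂ _-_ (adj-* Q g x) (adj-const Q x) ⟨
      adj (λ y → Q * g y) x - adj (λ _ → Q) x
        ≡⟨ adj-- (λ y → Q * g y) (λ _ → Q) x ⟨
      adj (λ y → Q * g y - Q) x
        ≡⟨ adj-cong shape x ⟨
      adj (λ y → adj balanced y + + q * balanced y) x
        ≡⟨ trans (M-below (M (a + 1ℤ) balanced) x) (adj-cong (M-above balanced) x) ⟨
      M (a + 1ℤ - 1ℤ) (M (a + 1ℤ) balanced) x
        ≡⟨ Ψ≡0⇒MM≡0 (a + 1ℤ) balanced Ψ-balanced x ⟩
      0ℤ
        ∎

  packing-relation : ∀ x → K n * + A C 0 x + + 2 * (+ q - 1ℤ) * + A C 1 x + + 2 * + A C 2 x ≡ K n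
  packing-relation x = begin
    K n * + A C 0 x + + 2 * (+ q - 1ℤ) * + A C 1 x + + 2 * + A C 2 x
      ≡⟨ regroup (K n) (+ q) (+ A C 0 x) (+ A C 1 x) (+ A C 2 x) ⟩
    K n * + A C 0 x + (+ q - + 2) * + A C 1 x + + 2 * + A C 2 x + + q * + A C 1 x
      ≡⟨ cong₂ (λ s t → s + + q * t) (adj²-𝟙C x) (adj-𝟙C x) ⟨
    adj (adj 𝟙C) x + + q * adj 𝟙C x
      ≡⟨ adj[adj+q]𝟙C≡K x ⟩
    K n
      ∎
    where regroup : ∀ K q a₀ a₁ a₂ → K * a₀ + + 2 * (q - 1ℤ) * a₁ + + 2 * a₂
                                     ≡ K * a₀ + (q - + 2) * a₁ + + 2 * a₂ + q * a₁
          regroup = solve-∀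

  K≢0 : K n ≢ 0ℤ
  K≢0 K≡0 with i*j≡0⇒i≡0∨j≡0 (+ n) K≡0
  ... | inj₁ n≡0   = contradiction (+-injective n≡0) (ℕₚ.m<n⇒n≢0 2≤n)
  ... | inj₂ q-1≡0 = contradiction (+-injective (i-j≡0⇒i≡j (+ q) 1ℤ q-1≡0)) (ℕₚ.>⇒≢ 2≤q)

  A₂≢0 : ∀ y → A C 0 y ≡ 0 → A C 1 y ≡ 0 → A C 2 y ≢ 0
  A₂≢0 y A₀≡0 A₁≡0 A₂≡0 = K≢0 (trans (sym (packing-relation y)) vanish)
    where
    at-zero : ∀ K q → K * 0ℤ + + 2 * (q - 1ℤ) * 0ℤ + + 2 * 0ℤ ≡ 0ℤ
    at-zero = solve-∀
    vanish : K n * + A C 0 y + + 2 * (+ q - 1ℤ) * + A C 1 y + + 2 * + A C 2 y ≡ 0ℤ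
    vanish rewrite A₀≡0 | A₁≡0 | A₂≡0 = at-zero (K n) (+ q)

  distanceOf : ∀ {y} → Position y → ℕ
  distanceOf (codeword _ _) = 0
  distanceOf (adjacent _ _) = 1
  distanceOf (far _ _)      = 2

  distC≡distanceOf : ∀ {y} (p : Position y) → distC C y ≡ distanceOf p
  distC≡distanceOf {y} (codeword A₀≡1 _)
    with count≢0⇒∃ (λ c → dist y c ≟ 0) (ℕₚ.1+n≢0 ∘ trans (sym A₀≡1))
  ... | c , c∈C , d₀ = distC-≡ C {y} c∈C d₀ (λ _ → ℕ.z≤n) ℕ.z≤n
  distC≡distanceOf {y} (adjacent A₀≡0 A₁≡1)
    with count≢0⇒∃ (λ c → dist y c ≟ 1) (ℕₚ.1+n≢0 ∘ trans (sym A₁≡1))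
  ... | c , c∈C , d₁ =
    distC-≡ C {y} c∈C d₁ (ℕₚ.n≢0⇒n>0 ∘ count≡0⇒¬P (λ c → dist y c ≟ 0) A₀≡0) (ℕₚ.<⇒≤ 2≤n)
  distC≡distanceOf {y} (far A₀≡0 A₁≡0)
    with count≢0⇒∃ (λ c → dist y c ≟ 2) (A₂≢0 y A₀≡0 A₁≡0)
  ... | c , c∈C , d₂ = distC-≡ C {y} c∈C d₂ beyond-1 2≤n
    where
    ≢0,1⇒≥2 : ∀ {d} → d ≢ 0 → d ≢ 1 → 2 ℕ.≤ d
    ≢0,1⇒≥2 {0}           d≢0 _   = contradiction refl d≢0
    ≢0,1⇒≥2 {1}           _   d≢1 = contradiction refl d≢1
    ≢0,1⇒≥2 {suc (suc _)} _   _   = ℕ.s≤s (ℕ.s≤s ℕ.z≤n)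
    beyond-1 : ∀ {c′} → c′ ∈ C → 2 ℕ.≤ dist y c′
    beyond-1 c′∈C = ≢0,1⇒≥2 (count≡0⇒¬P (λ c → dist y c ≟ 0) A₀≡0 c′∈C)
                            (count≡0⇒¬P (λ c → dist y c ≟ 1) A₁≡0 c′∈C)

  classAt : ℕ → ℤ → ℤ → ℤ
  classAt 0                   v _ = v
  classAt 1                   _ w = w
  classAt 2                   v w = 1ℤ - v - w
  classAt (suc (suc (suc _))) _ _ = 0ℤ

  distanceClass : ℕ → Word q n → ℤ
  distanceClass j y = classAt j (𝟙C y) (adj 𝟙C y)

  classAt-distanceOf : ∀ j {y} (p : Position y) → 𝟙 (distanceOf p ≟ j) ≡ classAt j (+ A C 0 y) (+ A C 1 y)
  classAt-distanceOf 0                   (codeword A₀≡1 _)     rewrite A₀≡1        = refl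
  classAt-distanceOf 1                   (codeword _ A₁≡0)     rewrite A₁≡0        = refl
  classAt-distanceOf 2                   (codeword A₀≡1 A₁≡0) rewrite A₀≡1 | A₁≡0 = refl
  classAt-distanceOf (suc (suc (suc _))) (codeword _ _)                            = refl
  classAt-distanceOf 0                   (adjacent A₀≡0 _)     rewrite A₀≡0        = refl
  classAt-distanceOf 1                   (adjacent _ A₁≡1)     rewrite A₁≡1        = refl
  classAt-distanceOf 2                   (adjacent A₀≡0 A₁≡1) rewrite A₀≡0 | A₁≡1 = refl
  classAt-distanceOf (suc (suc (suc _))) (adjacent _ _)                            = refl
  classAt-distanceOf 0                   (far A₀≡0 _)          rewrite A₀≡0        = refl
  classAt-distanceOf 1                   (far _ A₁≡0)          rewrite A₁≡0        = refl
  classAt-distanceOf 2                   (far A₀≡0 A₁≡0)      rewrite A₀≡0 | A₁≡0 = refl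
  classAt-distanceOf (suc (suc (suc _))) (far _ _)                                 = refl

  𝟙-distC≡distanceClass : ∀ j y → 𝟙 (distC C y ≟ j) ≡ distanceClass j y
  𝟙-distC≡distanceClass j y = begin
    𝟙 (distC C y ≟ j)             ≡⟨ cong (λ d → 𝟙 (d ≟ j)) (distC≡distanceOf p) ⟩
    𝟙 (distanceOf p ≟ j)          ≡⟨ classAt-distanceOf j p ⟩
    classAt j (𝟙C y) (+ A C 1 y)  ≡⟨ cong (classAt j (𝟙C y)) (adj-𝟙C y) ⟨
    classAt j (𝟙C y) (adj 𝟙C y)   ∎
    where p : Position y
          p = position y

  adjClassAt : ℕ → ℤ → ℤ
  adjClassAt 0                   t = t
  adjClassAt 1                   t = K n - + q * t
  adjClassAt 2                   t = (+ q - 1ℤ) * t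
  adjClassAt (suc (suc (suc _))) _ = 0ℤ

  adj-distanceClass : ∀ j x → adj (distanceClass j) x ≡ adjClassAt j (adj 𝟙C x)
  adj-distanceClass 0                   x = refl
  adj-distanceClass 1                   x = begin
    adj (adj 𝟙C) x
      ≡⟨ add-sub (adj (adj 𝟙C) x) (+ q * adj 𝟙C x) ⟩
    adj (adj 𝟙C) x + + q * adj 𝟙C x - + q * adj 𝟙C x
      ≡⟨ cong (_- + q * adj 𝟙C x) (adj[adj+q]𝟙C≡K x) ⟩
    K n - + q * adj 𝟙C x
      ∎
    where add-sub : ∀ s t → s ≡ s + t - t
          add-sub = solve-∀
  adj-distanceClass 2                   x = begin
    adj (λ y → 1ℤ - 𝟙C y - adj 𝟙C y) x
      ≡⟨ adj-- (λ y → 1ℤ - 𝟙C y) (adj 𝟙C) x ⟩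
    adj (λ y → 1ℤ - 𝟙C y) x - adj (adj 𝟙C) x
      ≡⟨ cong (_- adj (adj 𝟙C) x)
              (trans (adj-- (λ _ → 1ℤ) 𝟙C x) (cong (_- adj 𝟙C x) (adj-const 1ℤ x))) ⟩
    K n * 1ℤ - adj 𝟙C x - adj (adj 𝟙C) x
      ≡⟨ cong (λ t → K n * 1ℤ - adj 𝟙C x - t) (adj-distanceClass 1 x) ⟩
    K n * 1ℤ - adj 𝟙C x - (K n - + q * adj 𝟙C x)
      ≡⟨ collect (K n) (+ q) (adj 𝟙C x) ⟩
    (+ q - 1ℤ) * adj 𝟙C x
      ∎
    where collect : ∀ K q t → K * 1ℤ - t - (K - q * t) ≡ (q - 1ℤ) * t
          collect = solve-∀
  adj-distanceClass (suc (suc (suc _))) x = adj-zero x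

  completelyRegular : CompletelyRegular C
  completelyRegular i j x y dx≡i dy≡i = +-injective (begin
    + nbrsIn C j x           ≡⟨ nbrs x ⟩
    adjClassAt j (adj 𝟙C x)  ≡⟨ cong (adjClassAt j) same-class ⟩
    adjClassAt j (adj 𝟙C y)  ≡⟨ nbrs y ⟨
    + nbrsIn C j y           ∎)
    where
    nbrs : ∀ z → + nbrsIn C j z ≡ adjClassAt j (adj 𝟙C z)
    nbrs z = trans (nbrsIn≡adj C j z) (trans (adj-cong (𝟙-distC≡distanceClass j) z) (adj-distanceClass j z))
    same-class : adj 𝟙C x ≡ adj 𝟙C y
    same-class = begin
      adj 𝟙C x           ≡⟨ 𝟙-distC≡distanceClass 1 x ⟨
      𝟙 (distC C x ≟ 1)  ≡⟨ cong (λ d → 𝟙 (d ≟ 1)) (trans dx≡i (sym dy≡i)) ⟩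
      𝟙 (distC C y ≟ 1)  ≡⟨ 𝟙-distC≡distanceClass 1 y ⟩
      adj 𝟙C y           ∎

  uniformlyPacked₁ : UniformlyPacked₁ C
  uniformlyPacked₁ =
    α₀ , α₁ , α₂ , λ x → rescaled (+ A C 0 x) (+ A C 1 x) (+ A C 2 x) (packing-relation x)
    where open RationalEmbedding.Rescaled (K n) (+ 2 * (+ q - 1ℤ)) (+ 2) K≢0

module ShortenedHammingParameters
  (q′ k n : ℕ) .{{_ : ℕ.NonZero q′}}
  (n-relation : n ℕ.* q′ ℕ.+ suc q′ ≡ suc q′ ℕ.^ (2 ℕ.+ k))
  where

  open import Data.Nat using (_+_; _*_; _^_; _≤_)
  open import Data.Integer using (1ℤ; _-_)
  open import Data.Integer.Properties using (pos-+; pos-*)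
  open import Data.Integer.Tactic.RingSolver using (solve-∀)
  import Data.Nat.Tactic.RingSolver as ℕ-RingSolver

  private
    q m : ℕ
    q = suc q′
    m = 2 + k

  m[q-1]+q≤qᵐ : ∀ j → (2 + j) * q′ + q ≤ q ^ (2 + j)
  m[q-1]+q≤qᵐ zero = begin
    2 * q′ + q              ≡⟨ square-gap q′ ⟩
    suc (2 * q′) + q′       ≤⟨ ℕₚ.+-monoʳ-≤ (suc (2 * q′)) (ℕₚ.m≤m*n q′ q′) ⟩
    suc (2 * q′) + q′ * q′  ≡⟨ square q′ ⟩
    q ^ 2                   ∎
    where
    open ℕₚ.≤-Reasoning
    square-gap : ∀ r → 2 * r + (1 + r) ≡ 1 + 2 * r + r
    square-gap = ℕ-RingSolver.solve-∀
    square : ∀ r → 1 + 2 * r + r * r ≡ (1 + r) * ((1 + r) * 1)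
    square = ℕ-RingSolver.solve-∀
  m[q-1]+q≤qᵐ (suc j) = begin
    (3 + j) * q′ + q        ≡⟨ shift q′ j q ⟩
    q′ + ((2 + j) * q′ + q) ≤⟨ ℕₚ.+-monoʳ-≤ q′ (m[q-1]+q≤qᵐ j) ⟩
    q′ + qʲ                 ≤⟨ ℕₚ.+-monoˡ-≤ qʲ (ℕₚ.m≤m*n q′ qʲ {{ℕₚ.m^n≢0 q (2 + j)}}) ⟩
    q′ * qʲ + qʲ            ≡⟨ ℕₚ.+-comm (q′ * qʲ) qʲ ⟩
    q ^ (3 + j)             ∎
    where
    open ℕₚ.≤-Reasoning
    qʲ : ℕ
    qʲ = q ^ (2 + j)
    shift : ∀ r j q → (3 + j) * r + q ≡ r + ((2 + j) * r + q)
    shift = ℕ-RingSolver.solve-∀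

  m≤n : m ≤ n
  m≤n = ℕₚ.*-cancelʳ-≤ m n q′ (ℕₚ.+-cancelʳ-≤ q (m * q′) (n * q′) m[q-1]+q≤n[q-1]+q)
    where m[q-1]+q≤n[q-1]+q : m * q′ + q ≤ n * q′ + q
          m[q-1]+q≤n[q-1]+q = ℕₚ.≤-trans (m[q-1]+q≤qᵐ k) (ℕₚ.≤-reflexive (sym n-relation))

  2≤n : 2 ≤ n
  2≤n = ℕₚ.≤-trans (ℕ.s≤s (ℕ.s≤s ℕ.z≤n)) m≤n

  q∣K : HammingGraph.K q n ≡ + q ℤ.* (+ (q ^ suc k) - 1ℤ)
  q∣K = begin
    + n ℤ.* + q′                     ≡⟨ pos-* n q′ ⟨
    + (n * q′)                       ≡⟨ add-sub (+ (n * q′)) (+ q) ⟩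
    + (n * q′) ℤ.+ + q - + q         ≡⟨ cong (_- + q) (pos-+ (n * q′) q) ⟨
    + (n * q′ + q) - + q             ≡⟨ cong (λ t → + t - + q) n-relation ⟩
    + (q * q ^ suc k) - + q          ≡⟨ cong (_- + q) (pos-* q (q ^ suc k)) ⟩
    + q ℤ.* + (q ^ suc k) - + q      ≡⟨ factor (+ q) (+ (q ^ suc k)) ⟩
    + q ℤ.* (+ (q ^ suc k) - 1ℤ)     ∎
    where
    open ≡-Reasoning
    add-sub : ∀ a b → a ≡ a ℤ.+ b - b
    add-sub = solve-∀
    factor : ∀ q p → q ℤ.* p - q ≡ q ℤ.* (p - 1ℤ)
    factor = solve-∀

  size-condition : ∀ L → L ≡ q ^ (n ∸ m) → (HammingGraph.K q n ℤ.+ + q) ℤ.* + L ≡ + (q ^ n)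
  size-condition L L≡ = begin
    (+ n ℤ.* + q′ ℤ.+ + q) ℤ.* + L   ≡⟨ cong (λ t → (t ℤ.+ + q) ℤ.* + L) (pos-* n q′) ⟨
    (+ (n * q′) ℤ.+ + q) ℤ.* + L     ≡⟨ cong (ℤ._* + L) (pos-+ (n * q′) q) ⟨
    + (n * q′ + q) ℤ.* + L           ≡⟨ cong (λ t → + t ℤ.* + L) n-relation ⟩
    + (q ^ m) ℤ.* + L                ≡⟨ pos-* (q ^ m) L ⟨
    + (q ^ m * L)                    ≡⟨ cong (λ t → + (q ^ m * t)) L≡ ⟩
    + (q ^ m * q ^ (n ∸ m))          ≡⟨ cong +_ (ℕₚ.^-distribˡ-+-* q m (n ∸ m)) ⟨
    + (q ^ (m + (n ∸ m)))            ≡⟨ cong (λ t → + (q ^ t)) (ℕₚ.m+[n∸m]≡n m≤n) ⟩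
    + (q ^ n)                        ∎
    where open ≡-Reasoning

open import Data.Nat using (_+_; _*_; _∸_; _^_; _≤_; _<_)

corollary2 : (q m n : ℕ) → 2 < q → 2 ≤ m → n * (q ∸ 1) + q ≡ q ^ m →
    (C : Code q n) → IsCode C (q ^ (n ∸ m)) 3 →
    CompletelyRegular C × UniformlyPacked₁ C
corollary2 (suc q′) (suc (suc k)) n (ℕ.s≤s 2≤q′) (ℕ.s≤s (ℕ.s≤s ℕ.z≤n)) n-relation C
           (unique , |C|≡ , separated , _) = completelyRegular , uniformlyPacked₁
  where
  instance
    q′≢0 : ℕ.NonZero q′
    q′≢0 = ℕ.>-nonZero (ℕₚ.<-≤-trans (ℕ.s≤s ℕ.z≤n) 2≤q′)
  open ShortenedHammingParameters q′ k n n-relation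
  open ShortenedPerfectLike (suc q′) n (ℕₚ.m≤n⇒m≤1+n 2≤q′) 2≤n C unique separated
                            _ q∣K (size-condition _ |C|≡)
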